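{- For $n\ge1$: $h_n=\sum_{r=1}^np_rh_{n-r}$ and $ne_n=\sum_{r=1}^n(-1)^{r+1}p_re_{n-r}$. For $n\ge0$ (with $p_0=0$): $$(n+1)\tilde h_n=\sum_{r=0}^n\bigl[p_r\tilde h_{n-r}+(r+1)\tilde p_rh_{n-r}\bigr],\qquad (n+1)\tilde e_n=\sum_{r=0}^n(-1)^{r+1}\bigl[p_r\tilde e_{n-r}-(r+1)\tilde p_re_{n-r}\bigr].$$
   Context: Variables $x_1,x_2,\ldots$ commute; $\theta_1,\theta_2,\ldots$ anticommute among themselves and commute with the $x$'s. A superpartition of $(n|m)$ is $\Lambda=(\Lambda_1,\ldots,\Lambda_m;\Lambda_{m+1},\ldots)$ with $\Lambda_1>\cdots>\Lambda_m\ge0$, $\Lambda_{m+1}\ge\cdots\ge0$, total sum $n$; $m_\Lambda$ is the sum of all distinct terms $\theta_{i_1}\cdots\theta_{i_m}x_{i_1}^{\Lambda_1}\cdots x_{i_m}^{\Lambda_m}x_{j_1}^{\Lambda_{m+1}}\cdots$ over distinct indices. $e_0=1$, $e_n=\sum_{j_1<\cdots<j_n}x_{j_1}\cdots x_{j_n}$; $\tilde e_n=\sum_i\theta_i\sum_{j_1<\cdots<j_n,\,i\notin\{j_k\}}x_{j_1}\cdots x_{j_n}$; $h_n=\sum_{\lambda\vdash n}m_\lambda$; $\tilde h_n=\sum_{\Lambda\in\mathrm{SPar}(n|1)}(\Lambda_1+1)m_\Lambda$; $p_n=\sum_ix_i^n$ for $n\ge1$, $p_0=0$; $\tilde p_n=\sum_i\theta_ix_i^n$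 for $n\ge0$. -}

module Defs where

open import Data.Nat as ℕ using (ℕ; zero; suc; _∸_; _<ᵇ_; _≡ᵇ_)
open import Data.Integer as ℤ using (ℤ; +_; 0ℤ; 1ℤ; -_)
open import Data.Bool using (Bool; true; false; if_then_else_; _∧_; not)
open import Data.Product using (_×_; _,_)
open import Data.Fin using (Fin; _≟_)
open import Data.Vec as V using (Vec; []; _∷_)
open import Data.List as L using (List; []; _∷_; [_]; concatMap; upTo; allFin)
open import Relation.Nullary.Decidable using (⌊_⌋)
open import Relation.Binary.PropositionalEquality using (_≡_)

-- Superpolynomials in N even variables x_0..x_{N-1} and N odd variables
-- θ_0..θ_{N-1}, with integer coefficients.
-- A (normalised) monomial θ_S x^α: S is the set of θ's present
-- (as a Vec Bool), written in INCREASING index order, α the x-exponents.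

record Mono (N : ℕ) : Set where
  constructor mono
  field
    θs : Vec Bool N
    xs : Vec ℕ N

-- A superpolynomial is given by its coefficient function on normalised
-- monomials (all polynomials below are finitely supported).
SPoly : ℕ → Set
SPoly N = Mono N → ℤ

_≈_ : ∀ {N} → SPoly N → SPoly N → Set
f ≈ g = ∀ m → f m ≡ g m
infix 4 _≈_

0ₛ : ∀ {N} → SPoly N
0ₛ _ = 0ℤ

_+ₛ_ : ∀ {N} → SPoly N → SPoly N → SPoly N
(f +ₛ g) m = f m ℤ.+ g m
infixl 6 _+ₛ_

_·ₛ_ : ∀ {N} → ℤ → SPoly N → SPoly N
(c ·ₛ f) m = c ℤ.* f m
infixl 7 _·ₛ_

_-ₛ_ : ∀ {N} → SPoly N → SPoly N → SPoly N
f -ₛ g = f +ₛ ((- 1ℤ) ·ₛ g)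
infixl 6 _-ₛ_

negPow : ℕ → ℤ
negPow zero    = 1ℤ
negPow (suc k) = - negPow k

countT : ∀ {n} → Vec Bool n → ℕ
countT []          = 0
countT (true ∷ v)  = suc (countT v)
countT (false ∷ v) = countT v

sumℤ : List ℤ → ℤ
sumℤ = L.foldr ℤ._+_ 0ℤ

-- all ways to write a monomial θ_S x^α as (sign) · (θ_T x^β)(θ_U x^γ)
-- with S = T ⊔ U, α = β + γ; the sign comes from reordering the odd
-- variables: θ_T θ_U = (-1)^{#{(t,u) ∈ T×U : t > u}} θ_S.
decomp : ∀ {N} → Vec Bool N → Vec ℕ N → List (ℤ × Mono N × Mono N)
decomp [] [] = [ (1ℤ , mono [] [] , mono [] []) ]
decomp (b ∷ S) (a ∷ α) =
  concatMap (λ { (s , mono T β , mono U γ) →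
    concatMap (λ k →
      let l = a ∸ k in
      if b
      then (s , mono (true ∷ T) (k ∷ β) , mono (false ∷ U) (l ∷ γ))
           ∷ (s ℤ.* negPow (countT T) , mono (false ∷ T) (k ∷ β) , mono (true ∷ U) (l ∷ γ))
           ∷ []
      else [ (s , mono (false ∷ T) (k ∷ β) , mono (false ∷ U) (l ∷ γ)) ])
    (upTo (suc a)) })
  (decomp S α)

_*ₛ_ : ∀ {N} → SPoly N → SPoly N → SPoly N
(f *ₛ g) (mono S α) =
  sumℤ (L.map (λ { (s , m₁ , m₂) → s ℤ.* (f m₁ ℤ.* g m₂) }) (decomp S α))
infixl 7 _*ₛ_

ΣL : ∀ {N} {A : Set} → List A → (A → SPoly N) → SPoly N
ΣL xs f = L.foldr (λ a acc → f a +ₛ acc) 0ₛ xs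

Σ[_to_] : ∀ {N} → ℕ → ℕ → (ℕ → SPoly N) → SPoly N
Σ[ lo to hi ] f = ΣL (L.applyUpTo (λ i → lo ℕ.+ i) (suc hi ∸ lo)) f

eqVecBool : ∀ {n} → Vec Bool n → Vec Bool n → Bool
eqVecBool [] [] = true
eqVecBool (a ∷ u) (b ∷ v) = (if a then b else not b) ∧ eqVecBool u v

eqVecℕ : ∀ {n} → Vec ℕ n → Vec ℕ n → Bool
eqVecℕ [] [] = true
eqVecℕ (a ∷ u) (b ∷ v) = (a ≡ᵇ b) ∧ eqVecℕ u v

eqListℕ : List ℕ → List ℕ → Bool
eqListℕ [] [] = true
eqListℕ (a ∷ u) (b ∷ v) = (a ≡ᵇ b) ∧ eqListℕ u v
eqListℕ _ _ = false

mon : ∀ {N} → Mono N → SPoly N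
mon (mono S α) (mono S' α') =
  if eqVecBool S S' ∧ eqVecℕ α α' then 1ℤ else 0ℤ

single : ∀ {N} → Fin N → Vec Bool N
single i = V.tabulate (λ j → ⌊ i ≟ j ⌋)

powAt : ∀ {N} → Fin N → ℕ → Vec ℕ N
powAt i k = V.tabulate (λ j → if ⌊ i ≟ j ⌋ then k else 0)

allSubsets : ∀ N → List (Vec Bool N)
allSubsets zero    = [ [] ]
allSubsets (suc N) = concatMap (λ v → (false ∷ v) ∷ (true ∷ v) ∷ []) (allSubsets N)

indicator : ∀ {N} → Vec Bool N → Vec ℕ N
indicator = V.map (λ b → if b then 1 else 0)

p : ∀ {N} → ℕ → SPoly N
p zero    = 0ₛ
p {N} (suc n) = ΣL (allFin N) (λ i → mon (mono (V.replicate N false) (powAt i (suc n))))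

p~ : ∀ {N} → ℕ → SPoly N
p~ {N} n = ΣL (allFin N) (λ i → mon (mono (single i) (powAt i n)))

e : ∀ {N} → ℕ → SPoly N
e {N} n = ΣL (L.filter (λ J → countT J ℕ.≟ n) (allSubsets N))
             (λ J → mon (mono (V.replicate N false) (indicator J)))

e~ : ∀ {N} → ℕ → SPoly N
e~ {N} n = ΣL (allFin N) (λ i →
             ΣL (L.filter (λ J → countT J ℕ.≟ n) (allSubsets N)) (λ J →
               if V.lookup J i then 0ₛ
               else mon (mono (single i) (indicator J))))

-- A superpartition Λ = (Λ_1,…,Λ_m ; Λ_{m+1},…): fermionic parts
-- (strictly decreasing, may contain one 0) and bosonic parts (weakly
-- decreasing; trailing zeros omitted since they do not affect m_Λ).
record SPar : Set where
  constructor spar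
  field
    ferm : List ℕ
    bos  : List ℕ

insertD : ℕ → List ℕ → List ℕ
insertD a [] = [ a ]
insertD a (b ∷ bs) = if a <ᵇ b then b ∷ insertD a bs else a ∷ b ∷ bs

sortD : List ℕ → List ℕ
sortD = L.foldr insertD []

ascPairs : List ℕ → ℕ
ascPairs [] = 0
ascPairs (a ∷ u) = L.length (L.filter (λ b → a ℕ.<? b) u) ℕ.+ ascPairs u

fermExps : ∀ {N} → Vec Bool N → Vec ℕ N → List ℕ
fermExps [] [] = []
fermExps (true ∷ S) (a ∷ α) = a ∷ fermExps S α
fermExps (false ∷ S) (a ∷ α) = fermExps S α

bosExps : ∀ {N} → Vec Bool N → Vec ℕ N → List ℕ
bosExps [] [] = []
bosExps (true ∷ S) (a ∷ α) = bosExps S α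
bosExps (false ∷ S) (zero ∷ α) = bosExps S α
bosExps (false ∷ S) (suc a ∷ α) = suc a ∷ bosExps S α

-- m_Λ: sum of all distinct terms
--   θ_{i_1}⋯θ_{i_m} x_{i_1}^{Λ_1}⋯x_{i_m}^{Λ_m} x_{j_1}^{Λ_{m+1}}⋯ .
-- The coefficient at the normalised monomial θ_S x^α (θ's in increasing
-- index order) is the sign of the reordering from decreasing-exponent
-- order to increasing-index order when the exponent pattern matches Λ,
-- and 0 otherwise.
mΛ : ∀ {N} → SPar → SPoly N
mΛ (spar F B) (mono S α) =
  let fe = fermExps S α in
  if eqListℕ (sortD fe) F ∧ eqListℕ (sortD (bosExps S α)) (L.filter (λ b → 0 ℕ.<? b) B)
  then negPow (ascPairs fe) else 0ℤ

partsB : ℕ → ℕ → ℕ → List (List ℕ)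
partsB f zero k = [ [] ]
partsB zero (suc n) k = []
partsB (suc f) (suc n) k =
  concatMap (λ j → L.map (λ λs → suc j ∷ λs) (partsB f (suc n ∸ suc j) (suc j)))
            (upTo (ℕ._⊓_ k (suc n)))

Par : ℕ → List (List ℕ)
Par n = partsB n n n

SPar1 : ℕ → List SPar
SPar1 n = concatMap (λ a → L.map (λ λs → spar [ a ] λs) (Par (n ∸ a))) (upTo (suc n))

Λ₁ : SPar → ℕ
Λ₁ (spar [] B) = 0
Λ₁ (spar (a ∷ F) B) = a

h : ∀ {N} → ℕ → SPoly N
h n = ΣL (Par n) (λ λs → mΛ (spar [] λs))

h~ : ∀ {N} → ℕ → SPoly N
h~ n = ΣL (SPar1 n) (λ Λ → (+ suc (Λ₁ Λ)) ·ₛ mΛ Λ)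

module Submission where

-- Induction on the number of variables.  A superpolynomial is determined by its slices: the
-- coefficients of θ₀ᵇ x₀ᵃ, superpolynomials in the remaining variables.  Regard each family as a
-- sequence in its degree n, with Cauchy product ⋆ and `shift a` playing multiplication by tᵃ.
-- Adjoining x₀, θ₀ turns p_r into p_r + x₀ʳ and p~_r into p~_r + θ₀ x₀ʳ, so the x₀ᵃ-slice of p ⋆ B
-- is p ⋆ (x₀ᵃ-slice of B) plus, for 1 ≤ k ≤ a, the k-fold shift of the x₀ᵃ⁻ᵏ-slice of B.  The
-- x₀ᵃ-slices of h and h~ are their a-fold shifts, while e and e~ only have x₀⁰-, x₀¹- and θ₀-slices.
-- Each identity in N + 1 variables thus becomes, slice by slice, an identity in N variables (the
-- same one, or the one for h or e) plus shifted corrections: these supply the term a·B_{n-a} that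
-- the Euler operator n ↦ n·B_n picks up under a shift, or they cancel by alternation of signs.

open import Defs
open import Algebra.Bundles using (CommutativeMonoid)
import Algebra.Construct.Pointwise as Pointwise
open import Data.Bool using (Bool; true; false; if_then_else_; _∧_; not; T)
open import Data.Empty using (⊥; ⊥-elim)
open import Data.Fin as Fin using (Fin; zero; suc; _≟_)
import Data.Fin.Properties as FinP
open import Data.Integer as ℤ using (ℤ; +_; 0ℤ; 1ℤ; -_; _+_; _*_)
import Data.Integer.Properties as ℤP
open import Data.Integer.Tactic.RingSolver using (solve-∀)
open import Data.List as L using (List; []; _∷_; [_]; concatMap; upTo; allFin; _++_)
open import Data.Nat as ℕ using (ℕ; zero; suc; _≤_; _<_; _∸_; _≡ᵇ_; _<ᵇ_; z≤n; s≤s)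
open import Data.Nat.ListAction using () renaming (sum to sumℕ)
import Data.Nat.Properties as ℕP
open import Data.Product using (_×_; _,_)
open import Data.Unit using (⊤; tt)
open import Data.Vec as V using (Vec; []; _∷_)
import Data.Vec.Properties as VP
open import Function using (_∘_; id)
open import Relation.Binary.Bundles using (Setoid)
open import Relation.Binary.PropositionalEquality
  using (_≡_; _≢_; refl; sym; trans; cong; cong₂; subst; module ≡-Reasoning)
import Relation.Binary.Reasoning.Setoid as SetoidReasoning
open import Relation.Nullary.Decidable using (⌊_⌋; ⌊⌋-map′)

module Sums {c ℓ} (M : CommutativeMonoid c ℓ) where

  open CommutativeMonoid M renaming (_≈_ to _≃_; refl to ≈-refl; sym to ≈-sym; trans to ≈-trans)
  open SetoidReasoning setoid

  sumList : {A : Set} → List A → (A → Carrier) → Carrier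
  sumList xs f = L.foldr (λ x acc → f x ∙ acc) ε xs

  ∑ : ℕ → (ℕ → Carrier) → Carrier
  ∑ zero    f = ε
  ∑ (suc n) f = f 0 ∙ ∑ n (f ∘ suc)

  private
    interchange : ∀ a b c d → (a ∙ b) ∙ (c ∙ d) ≃ (a ∙ c) ∙ (b ∙ d)
    interchange a b c d = begin
      (a ∙ b) ∙ (c ∙ d) ≈⟨ assoc a b (c ∙ d) ⟩
      a ∙ (b ∙ (c ∙ d)) ≈⟨ ∙-congˡ (x∙yz≈y∙xz b c d) ⟩
      a ∙ (c ∙ (b ∙ d)) ≈⟨ ≈-sym (assoc a c (b ∙ d)) ⟩
      (a ∙ c) ∙ (b ∙ d) ∎
      where
      x∙yz≈y∙xz : ∀ x y z → x ∙ (y ∙ z) ≃ y ∙ (x ∙ z)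
      x∙yz≈y∙xz x y z = ≈-trans (≈-sym (assoc x y z)) (≈-trans (∙-congʳ (comm x y)) (assoc y x z))

  sumList-cong : {A : Set} (xs : List A) {f g : A → Carrier} →
                 (∀ x → f x ≃ g x) → sumList xs f ≃ sumList xs g
  sumList-cong []       f≈g = ≈-refl
  sumList-cong (x ∷ xs) f≈g = ∙-cong (f≈g x) (sumList-cong xs f≈g)

  sumList-++ : {A : Set} (xs ys : List A) (f : A → Carrier) →
               sumList (xs ++ ys) f ≃ sumList xs f ∙ sumList ys f
  sumList-++ []       ys f = ≈-sym (identityˡ _)
  sumList-++ (x ∷ xs) ys f = ≈-trans (∙-congˡ (sumList-++ xs ys f)) (≈-sym (assoc _ _ _))

  sumList-concatMap : {A B : Set} (g : A → List B) (xs : List A) (f : B → Carrier) →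
                      sumList (concatMap g xs) f ≃ sumList xs (λ x → sumList (g x) f)
  sumList-concatMap g []       f = ≈-refl
  sumList-concatMap g (x ∷ xs) f =
    ≈-trans (sumList-++ (g x) (concatMap g xs) f) (∙-congˡ (sumList-concatMap g xs f))

  sumList-map : {A B : Set} (g : A → B) (xs : List A) (f : B → Carrier) →
                sumList (L.map g xs) f ≃ sumList xs (f ∘ g)
  sumList-map g []       f = ≈-refl
  sumList-map g (x ∷ xs) f = ∙-congˡ (sumList-map g xs f)

  sumList-∙ : {A : Set} (xs : List A) (f g : A → Carrier) →
              sumList xs (λ x → f x ∙ g x) ≃ sumList xs f ∙ sumList xs g
  sumList-∙ []       f g = ≈-sym (identityˡ ε)
  sumList-∙ (x ∷ xs) f g = ≈-trans (∙-congˡ (sumList-∙ xs f g)) (interchange _ _ _ _)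

  sumList-ε : {A : Set} (xs : List A) {f : A → Carrier} → (∀ x → f x ≃ ε) → sumList xs f ≃ ε
  sumList-ε []       f≈ε = ≈-refl
  sumList-ε (x ∷ xs) f≈ε = ≈-trans (∙-cong (f≈ε x) (sumList-ε xs f≈ε)) (identityˡ ε)

  sumList-applyUpTo : (g : ℕ → ℕ) (n : ℕ) (f : ℕ → Carrier) →
                      sumList (L.applyUpTo g n) f ≃ ∑ n (f ∘ g)
  sumList-applyUpTo g zero    f = ≈-refl
  sumList-applyUpTo g (suc n) f = ∙-congˡ (sumList-applyUpTo (g ∘ suc) n f)

  ∑-cong : ∀ n {f g : ℕ → Carrier} → (∀ i → i < n → f i ≃ g i) → ∑ n f ≃ ∑ n g
  ∑-cong zero    f≈g = ≈-refl
  ∑-cong (suc n) f≈g = ∙-cong (f≈g 0 (s≤s z≤n)) (∑-cong n (λ i i<n → f≈g (suc i) (s≤s i<n)))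

  ∑-zero : ∀ n {f : ℕ → Carrier} → (∀ i → i < n → f i ≃ ε) → ∑ n f ≃ ε
  ∑-zero zero    f≈ε = ≈-refl
  ∑-zero (suc n) f≈ε =
    ≈-trans (∙-cong (f≈ε 0 (s≤s z≤n)) (∑-zero n (λ i i<n → f≈ε (suc i) (s≤s i<n)))) (identityˡ ε)

  ∑-∙ : ∀ n (f g : ℕ → Carrier) → ∑ n (λ i → f i ∙ g i) ≃ ∑ n f ∙ ∑ n g
  ∑-∙ zero    f g = ≈-sym (identityˡ ε)
  ∑-∙ (suc n) f g = ≈-trans (∙-congˡ (∑-∙ n (f ∘ suc) (g ∘ suc))) (interchange _ _ _ _)

  ∑-snoc : ∀ n (f : ℕ → Carrier) → ∑ (suc n) f ≃ ∑ n f ∙ f n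
  ∑-snoc zero    f = ≈-trans (identityʳ (f 0)) (≈-sym (identityˡ (f 0)))
  ∑-snoc (suc n) f = ≈-trans (∙-congˡ (∑-snoc n (f ∘ suc))) (≈-sym (assoc _ _ _))

  ∑-swap : ∀ m n (F : ℕ → ℕ → Carrier) → ∑ m (λ i → ∑ n (F i)) ≃ ∑ n (λ j → ∑ m (λ i → F i j))
  ∑-swap zero    n F = ≈-sym (∑-zero n (λ _ _ → ≈-refl))
  ∑-swap (suc m) n F = ≈-trans (∙-congˡ (∑-swap m n (F ∘ suc))) (≈-sym (∑-∙ n (F 0) _))

  sumList-∑ : {A : Set} (xs : List A) (n : ℕ) (F : A → ℕ → Carrier) →
              sumList xs (λ x → ∑ n (F x)) ≃ ∑ n (λ i → sumList xs (λ x → F x i))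
  sumList-∑ []       n F = ≈-sym (∑-zero n (λ _ _ → ≈-refl))
  sumList-∑ (x ∷ xs) n F = ≈-trans (∙-congˡ (sumList-∑ xs n F)) (≈-sym (∑-∙ n (F x) _))

module SumsHom {c₁ ℓ₁ c₂ ℓ₂} (M₁ : CommutativeMonoid c₁ ℓ₁) (M₂ : CommutativeMonoid c₂ ℓ₂)
  (φ : CommutativeMonoid.Carrier M₁ → CommutativeMonoid.Carrier M₂)
  (φ-ε : CommutativeMonoid._≈_ M₂ (φ (CommutativeMonoid.ε M₁)) (CommutativeMonoid.ε M₂))
  (φ-∙ : ∀ x y → CommutativeMonoid._≈_ M₂ (φ (CommutativeMonoid._∙_ M₁ x y))
                                           (CommutativeMonoid._∙_ M₂ (φ x) (φ y)))
  where

  open CommutativeMonoid M₂ using (∙-congˡ) renaming (_≈_ to _≃_; trans to ≈-trans)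
  open Sums M₁ renaming (sumList to sumList₁; ∑ to ∑₁)
  open Sums M₂ renaming (sumList to sumList₂; ∑ to ∑₂)

  sumList-hom : {A : Set} (xs : List A) (f : A → _) → φ (sumList₁ xs f) ≃ sumList₂ xs (φ ∘ f)
  sumList-hom []       f = φ-ε
  sumList-hom (x ∷ xs) f = ≈-trans (φ-∙ _ _) (∙-congˡ (sumList-hom xs f))

  ∑-hom : ∀ n f → φ (∑₁ n f) ≃ ∑₂ n (φ ∘ f)
  ∑-hom zero    f = φ-ε
  ∑-hom (suc n) f = ≈-trans (φ-∙ _ _) (∙-congˡ (∑-hom n (f ∘ suc)))

+ₛ-commutativeMonoid : ℕ → CommutativeMonoid _ _
+ₛ-commutativeMonoid N = record
  { Carrier             = SPoly N
  ; _≈_                 = _≈_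
  ; _∙_                 = _+ₛ_
  ; ε                   = 0ₛ
  ; isCommutativeMonoid = Pointwise.isCommutativeMonoid (Mono N) ℤP.+-0-isCommutativeMonoid
  }

module ℤΣ = Sums ℤP.+-0-commutativeMonoid
open module PolySums {N} = Sums (+ₛ-commutativeMonoid N) using (∑; ∑-cong; ∑-zero; ∑-snoc; ∑-swap; ∑-∙)

module ≈-Reasoning {N} = SetoidReasoning (CommutativeMonoid.setoid (+ₛ-commutativeMonoid N))

≈-refl : ∀ {N} {f : SPoly N} → f ≈ f
≈-refl _ = refl

≈-sym : ∀ {N} {f g : SPoly N} → f ≈ g → g ≈ f
≈-sym f≈g m = sym (f≈g m)

≈-trans : ∀ {N} {f g k : SPoly N} → f ≈ g → g ≈ k → f ≈ k
≈-trans f≈g g≈k m = trans (f≈g m) (g≈k m)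

≈-reflexive : ∀ {N} {f g : SPoly N} → f ≡ g → f ≈ g
≈-reflexive refl = ≈-refl

+ₛ-cong : ∀ {N} {f f′ g g′ : SPoly N} → f ≈ f′ → g ≈ g′ → f +ₛ g ≈ f′ +ₛ g′
+ₛ-cong f≈f′ g≈g′ m = cong₂ _+_ (f≈f′ m) (g≈g′ m)

·ₛ-cong : ∀ {N} c {f g : SPoly N} → f ≈ g → c ·ₛ f ≈ c ·ₛ g
·ₛ-cong c f≈g m = cong (c *_) (f≈g m)

·ₛ-zeroʳ : ∀ {N} c → c ·ₛ 0ₛ {N} ≈ 0ₛ
·ₛ-zeroʳ c _ = ℤP.*-zeroʳ c

·ₛ-identityˡ : ∀ {N} (f : SPoly N) → 1ℤ ·ₛ f ≈ f
·ₛ-identityˡ f m = ℤP.*-identityˡ (f m)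

·ₛ-∑ : ∀ {N} c n (F : ℕ → SPoly N) → c ·ₛ ∑ n F ≈ ∑ n (λ i → c ·ₛ F i)
·ₛ-∑ c = SumsHom.∑-hom (+ₛ-commutativeMonoid _) (+ₛ-commutativeMonoid _) (c ·ₛ_)
  (·ₛ-zeroʳ c) (λ f g m → ℤP.*-distribˡ-+ c (f m) (g m))

∑-at : ∀ {N} n (F : ℕ → SPoly N) m → ∑ n F m ≡ ℤΣ.∑ n (λ i → F i m)
∑-at n F m = SumsHom.∑-hom (+ₛ-commutativeMonoid _) ℤP.+-0-commutativeMonoid (λ f → f m)
  refl (λ _ _ → refl) n F

ΣL-at : ∀ {N} {A : Set} (xs : List A) (F : A → SPoly N) m → ΣL xs F m ≡ ℤΣ.sumList xs (λ x → F x m)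
ΣL-at xs F m = SumsHom.sumList-hom (+ₛ-commutativeMonoid _) ℤP.+-0-commutativeMonoid (λ f → f m)
  refl (λ _ _ → refl) xs F

sumList-*ℤ : ∀ {A : Set} c (xs : List A) (f : A → ℤ) → ℤΣ.sumList xs (λ x → c * f x) ≡ c * ℤΣ.sumList xs f
sumList-*ℤ c xs f = sym (SumsHom.sumList-hom ℤP.+-0-commutativeMonoid ℤP.+-0-commutativeMonoid (c *_)
  (ℤP.*-zeroʳ c) (ℤP.*-distribˡ-+ c) xs f)

∑-const : ∀ {N} n (f : SPoly N) → ∑ n (λ _ → f) ≈ (+ n) ·ₛ f
∑-const zero    f m = sym (ℤP.*-zeroˡ (f m))
∑-const (suc n) f m = trans (cong (_+_ (f m)) (∑-const n f m)) (distrib (+ n) (f m))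
  where
  distrib : ∀ k x → x + k * x ≡ (1ℤ + k) * x
  distrib = solve-∀

ΣL-·ₛ : ∀ {N} {A : Set} c (xs : List A) (F : A → SPoly N) → ΣL xs (λ x → c ·ₛ F x) ≈ c ·ₛ ΣL xs F
ΣL-·ₛ c xs F = ≈-sym (SumsHom.sumList-hom (+ₛ-commutativeMonoid _) (+ₛ-commutativeMonoid _) (c ·ₛ_)
  (·ₛ-zeroʳ c) (λ f g m → ℤP.*-distribˡ-+ c (f m) (g m)) xs F)

ΣL-+ₛ : ∀ {N} {A : Set} (xs : List A) (F G : A → SPoly N) → ΣL xs (λ x → F x +ₛ G x) ≈ ΣL xs F +ₛ ΣL xs G
ΣL-+ₛ = PolySums.sumList-∙

ΣL-allFin-suc : ∀ {N M} (F : Fin (suc N) → SPoly M) → ΣL (allFin (suc N)) F ≈ F zero +ₛ ΣL (allFin N) (F ∘ suc)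
ΣL-allFin-suc {N} F = +ₛ-cong {f = F zero} ≈-refl (tabulate-shift {g = suc} {h = id} (λ _ → ≈-refl))
  where
  tabulate-shift : ∀ {n} {g : Fin n → Fin (suc N)} {h : Fin n → Fin N} → (∀ i → F (g i) ≈ F (suc (h i))) →
                   ΣL (L.tabulate g) F ≈ ΣL (L.tabulate h) (F ∘ suc)
  tabulate-shift {zero}  eq = ≈-refl
  tabulate-shift {suc n} eq = +ₛ-cong (eq zero) (tabulate-shift (eq ∘ suc))

productTerm : ∀ {N} → SPoly N → SPoly N → ℤ × Mono N × Mono N → ℤ
productTerm f g (s , m₁ , m₂) = s * (f m₁ * g m₂)

*ₛ-coefficient : ∀ {N} (f g : SPoly N) S α → (f *ₛ g) (mono S α) ≡ ℤΣ.sumList (decomp S α) (productTerm f g)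
*ₛ-coefficient f g S α = sumℤ-map (decomp S α)
  where
  sumℤ-map : ∀ ts → sumℤ (L.map (productTerm f g) ts) ≡ ℤΣ.sumList ts (productTerm f g)
  sumℤ-map []       = refl
  sumℤ-map (t ∷ ts) = cong (_+_ (productTerm f g t)) (sumℤ-map ts)

*ₛ-rescale : ∀ {N} {f g f′ g′ : SPoly N} c →
             (∀ m₁ m₂ → f m₁ * g m₂ ≡ c * (f′ m₁ * g′ m₂)) → f *ₛ g ≈ c ·ₛ (f′ *ₛ g′)
*ₛ-rescale {f = f} {g} {f′} {g′} c eq (mono S α) = begin
  (f *ₛ g) (mono S α)                            ≡⟨ *ₛ-coefficient f g S α ⟩
  ℤΣ.sumList ts (productTerm f g)                ≡⟨ ℤΣ.sumList-cong ts termwise ⟩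
  ℤΣ.sumList ts (λ t → c * productTerm f′ g′ t)  ≡⟨ sumList-*ℤ c ts (productTerm f′ g′) ⟩
  c * ℤΣ.sumList ts (productTerm f′ g′)          ≡⟨ cong (c *_) (sym (*ₛ-coefficient f′ g′ S α)) ⟩
  c * (f′ *ₛ g′) (mono S α)                      ∎
  where
  open ≡-Reasoning
  ts = decomp S α
  termwise : ∀ t → productTerm f g t ≡ c * productTerm f′ g′ t
  termwise (s , m₁ , m₂) = trans (cong (s *_) (eq m₁ m₂)) (swap s c (f′ m₁ * g′ m₂))
    where
    swap : ∀ s c x → s * (c * x) ≡ c * (s * x)
    swap = solve-∀

*ₛ-cong : ∀ {N} {f f′ g g′ : SPoly N} → f ≈ f′ → g ≈ g′ → f *ₛ g ≈ f′ *ₛ g′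
*ₛ-cong {f = f} {f′} {g} {g′} f≈f′ g≈g′ (mono S α) = begin
  (f *ₛ g) (mono S α)                ≡⟨ *ₛ-coefficient f g S α ⟩
  ℤΣ.sumList ts (productTerm f g)    ≡⟨ ℤΣ.sumList-cong ts termwise ⟩
  ℤΣ.sumList ts (productTerm f′ g′)  ≡⟨ sym (*ₛ-coefficient f′ g′ S α) ⟩
  (f′ *ₛ g′) (mono S α)              ∎
  where
  open ≡-Reasoning
  ts = decomp S α
  termwise : ∀ t → productTerm f g t ≡ productTerm f′ g′ t
  termwise (s , m₁ , m₂) = cong₂ (λ x y → s * (x * y)) (f≈f′ m₁) (g≈g′ m₂)

*ₛ-zeroˡ : ∀ {N} (g : SPoly N) → 0ₛ *ₛ g ≈ 0ₛ
*ₛ-zeroˡ g m = trans (*ₛ-rescale {f = 0ₛ} {g} {0ₛ} {g} 0ℤ (λ _ m₂ → zeros (g m₂)) m) (ℤP.*-zeroˡ ((0ₛ *ₛ g) m))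
  where
  zeros : ∀ y → 0ℤ * y ≡ 0ℤ * (0ℤ * y)
  zeros = solve-∀

*ₛ-zeroʳ : ∀ {N} (f : SPoly N) → f *ₛ 0ₛ ≈ 0ₛ
*ₛ-zeroʳ f m = trans (*ₛ-rescale {f = f} {0ₛ} {f} {0ₛ} 0ℤ (λ m₁ _ → zeros (f m₁)) m) (ℤP.*-zeroˡ ((f *ₛ 0ₛ) m))
  where
  zeros : ∀ x → x * 0ℤ ≡ 0ℤ * (x * 0ℤ)
  zeros = solve-∀

·ₛ-*ₛ : ∀ {N} c (f g : SPoly N) → (c ·ₛ f) *ₛ g ≈ c ·ₛ (f *ₛ g)
·ₛ-*ₛ c f g = *ₛ-rescale {f = c ·ₛ f} {g} {f} {g} c (λ m₁ m₂ → ℤP.*-assoc c (f m₁) (g m₂))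

*ₛ-·ₛ : ∀ {N} c (f g : SPoly N) → f *ₛ (c ·ₛ g) ≈ c ·ₛ (f *ₛ g)
*ₛ-·ₛ c f g = *ₛ-rescale {f = f} {c ·ₛ g} {f} {g} c (λ m₁ m₂ → move (f m₁) c (g m₂))
  where
  move : ∀ x c y → x * (c * y) ≡ c * (x * y)
  move = solve-∀

-- Slicing off the first variable

slice : ∀ {N} → Bool → ℕ → SPoly (suc N) → SPoly N
slice b a f (mono S α) = f (mono (b ∷ S) (a ∷ α))

slice-cong : ∀ {N} b a {f g : SPoly (suc N)} → f ≈ g → slice b a f ≈ slice b a g
slice-cong b a f≈g (mono S α) = f≈g (mono (b ∷ S) (a ∷ α))

slice-∑ : ∀ {N} b a n (F : ℕ → SPoly (suc N)) → slice b a (∑ n F) ≈ ∑ n (slice b a ∘ F)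
slice-∑ b a = SumsHom.∑-hom (+ₛ-commutativeMonoid _) (+ₛ-commutativeMonoid _) (slice b a)
  ≈-refl (λ _ _ → ≈-refl)

slice-ΣL : ∀ {N} {A : Set} b a (xs : List A) (F : A → SPoly (suc N)) → slice b a (ΣL xs F) ≈ ΣL xs (slice b a ∘ F)
slice-ΣL b a = SumsHom.sumList-hom (+ₛ-commutativeMonoid _) (+ₛ-commutativeMonoid _) (slice b a)
  ≈-refl (λ _ _ → ≈-refl)

≈-by-slices : ∀ {N} {f g : SPoly (suc N)} → (∀ b a → slice b a f ≈ slice b a g) → f ≈ g
≈-by-slices f≈g (mono (b ∷ S) (a ∷ α)) = f≈g b a (mono S α)

-- σ negates every θ; it enters because θ₀ of a right factor must pass the θ's of the left one.
σ : ∀ {N} → SPoly N → SPoly N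
σ f (mono S α) = negPow (countT S) * f (mono S α)

σ-cong : ∀ {N} {f g : SPoly N} → f ≈ g → σ f ≈ σ g
σ-cong f≈g (mono S α) = cong (negPow (countT S) *_) (f≈g (mono S α))

σ-ΣL : ∀ {N} {A : Set} (xs : List A) (F : A → SPoly N) → σ (ΣL xs F) ≈ ΣL xs (σ ∘ F)
σ-ΣL = SumsHom.sumList-hom (+ₛ-commutativeMonoid _) (+ₛ-commutativeMonoid _) σ
  (λ { (mono S α) → ℤP.*-zeroʳ (negPow (countT S)) })
  (λ f g → λ { (mono S α) → ℤP.*-distribˡ-+ (negPow (countT S)) (f (mono S α)) (g (mono S α)) })

-- branch is the inner expansion in the definition of decomp, so decomp (b ∷ S) (a ∷ α) unfolds to it.
private
  branch : ∀ {N} → Bool → ℕ → ℤ × Mono N × Mono N → ℕ → List (ℤ × Mono (suc N) × Mono (suc N))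
  branch b a (s , mono T β , mono U γ) k =
    if b
    then (s , mono (true ∷ T) (k ∷ β) , mono (false ∷ U) (a ∸ k ∷ γ))
         ∷ (s * negPow (countT T) , mono (false ∷ T) (k ∷ β) , mono (true ∷ U) (a ∸ k ∷ γ))
         ∷ []
    else [ (s , mono (false ∷ T) (k ∷ β) , mono (false ∷ U) (a ∸ k ∷ γ)) ]

  *ₛ-coefficient-split : ∀ {N} (f g : SPoly (suc N)) b a S α →
    (f *ₛ g) (mono (b ∷ S) (a ∷ α))
      ≡ ℤΣ.∑ (suc a) (λ k → ℤΣ.sumList (decomp S α) (λ t → ℤΣ.sumList (branch b a t k) (productTerm f g)))
  *ₛ-coefficient-split f g b a S α = begin
    (f *ₛ g) (mono (b ∷ S) (a ∷ α))
      ≡⟨ *ₛ-coefficient f g (b ∷ S) (a ∷ α) ⟩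
    ℤΣ.sumList (concatMap (λ t → concatMap (branch b a t) (upTo (suc a))) ts) (productTerm f g)
      ≡⟨ ℤΣ.sumList-concatMap _ ts (productTerm f g) ⟩
    ℤΣ.sumList ts (λ t → ℤΣ.sumList (concatMap (branch b a t) (upTo (suc a))) (productTerm f g))
      ≡⟨ ℤΣ.sumList-cong ts (λ t → trans (ℤΣ.sumList-concatMap (branch b a t) (upTo (suc a)) (productTerm f g))
                                         (ℤΣ.sumList-applyUpTo id (suc a) (λ k → ℤΣ.sumList (branch b a t k) (productTerm f g)))) ⟩
    ℤΣ.sumList ts (λ t → ℤΣ.∑ (suc a) (λ k → ℤΣ.sumList (branch b a t k) (productTerm f g)))
      ≡⟨ ℤΣ.sumList-∑ ts (suc a) (λ t k → ℤΣ.sumList (branch b a t k) (productTerm f g)) ⟩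
    ℤΣ.∑ (suc a) (λ k → ℤΣ.sumList ts (λ t → ℤΣ.sumList (branch b a t k) (productTerm f g))) ∎
    where
    open ≡-Reasoning
    ts = decomp S α

slice-*ₛ-false : ∀ {N} a (f g : SPoly (suc N)) →
  slice false a (f *ₛ g) ≈ ∑ (suc a) (λ k → slice false k f *ₛ slice false (a ∸ k) g)
slice-*ₛ-false a f g (mono S α) = begin
  (f *ₛ g) (mono (false ∷ S) (a ∷ α))
    ≡⟨ *ₛ-coefficient-split f g false a S α ⟩
  ℤΣ.∑ (suc a) (λ k → ℤΣ.sumList (decomp S α) (λ t → ℤΣ.sumList (branch false a t k) (productTerm f g)))
    ≡⟨ ℤΣ.∑-cong (suc a) (λ k _ → trans (ℤΣ.sumList-cong (decomp S α) (λ t → ℤP.+-identityʳ (productTerm (L k) (R k) t)))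
                                        (sym (*ₛ-coefficient (L k) (R k) S α))) ⟩
  ℤΣ.∑ (suc a) (λ k → (L k *ₛ R k) (mono S α))
    ≡⟨ sym (∑-at (suc a) (λ k → L k *ₛ R k) (mono S α)) ⟩
  ∑ (suc a) (λ k → L k *ₛ R k) (mono S α) ∎
  where
  open ≡-Reasoning
  L R : ℕ → SPoly _
  L k = slice false k f
  R k = slice false (a ∸ k) g

slice-*ₛ-true : ∀ {N} a (f g : SPoly (suc N)) →
  slice true a (f *ₛ g)
    ≈ ∑ (suc a) (λ k → slice true k f *ₛ slice false (a ∸ k) g +ₛ σ (slice false k f) *ₛ slice true (a ∸ k) g)
slice-*ₛ-true a f g (mono S α) = begin
  (f *ₛ g) (mono (true ∷ S) (a ∷ α))
    ≡⟨ *ₛ-coefficient-split f g true a S α ⟩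
  ℤΣ.∑ (suc a) (λ k → ℤΣ.sumList (decomp S α) (λ t → ℤΣ.sumList (branch true a t k) (productTerm f g)))
    ≡⟨ ℤΣ.∑-cong (suc a) (λ k _ → trans (ℤΣ.sumList-cong (decomp S α) (two-terms k))
         (trans (ℤΣ.sumList-∙ (decomp S α) (productTerm (L k) (R k)) (productTerm (L′ k) (R′ k)))
                (sym (cong₂ _+_ (*ₛ-coefficient (L k) (R k) S α) (*ₛ-coefficient (L′ k) (R′ k) S α))))) ⟩
  ℤΣ.∑ (suc a) (λ k → (L k *ₛ R k +ₛ L′ k *ₛ R′ k) (mono S α))
    ≡⟨ sym (∑-at (suc a) (λ k → L k *ₛ R k +ₛ L′ k *ₛ R′ k) (mono S α)) ⟩
  ∑ (suc a) (λ k → L k *ₛ R k +ₛ L′ k *ₛ R′ k) (mono S α) ∎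
  where
  open ≡-Reasoning
  L R L′ R′ : ℕ → SPoly _
  L k  = slice true k f
  R k  = slice false (a ∸ k) g
  L′ k = σ (slice false k f)
  R′ k = slice true (a ∸ k) g
  two-terms : ∀ k t → ℤΣ.sumList (branch true a t k) (productTerm f g) ≡ productTerm (L k) (R k) t + productTerm (L′ k) (R′ k) t
  two-terms k (s , mono T β , mono U γ) =
    regroup s (negPow (countT T)) (L k (mono T β)) (R k (mono U γ)) (slice false k f (mono T β)) (R′ k (mono U γ))
    where
    regroup : ∀ s ε x y z w → s * (x * y) + (s * ε * (z * w) + 0ℤ) ≡ s * (x * y) + s * ((ε * z) * w)
    regroup = solve-∀

χ : Bool → ℤ
χ b = if b then 1ℤ else 0ℤ

sameBit : Bool → Bool → Bool
sameBit b′ b = if b′ then b else not b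

slice-mon : ∀ {N} b a b′ a′ (S′ : Vec Bool N) α′ →
  slice b a (mon (mono (b′ ∷ S′) (a′ ∷ α′))) ≈ χ (sameBit b′ b ∧ (a′ ≡ᵇ a)) ·ₛ mon (mono S′ α′)
slice-mon b a b′ a′ S′ α′ (mono S α)
  with sameBit b′ b | a′ ≡ᵇ a | eqVecBool S′ S | eqVecℕ α′ α
... | false | _     | _     | _     = refl
... | true  | false | false | _     = refl
... | true  | false | true  | false = refl
... | true  | false | true  | true  = refl
... | true  | true  | false | _     = refl
... | true  | true  | true  | false = refl
... | true  | true  | true  | true  = refl

eqVecBool-sound : ∀ {n} (S T : Vec Bool n) → eqVecBool S T ≡ true → S ≡ T
eqVecBool-sound []          []          _  = refl
eqVecBool-sound (true ∷ S)  (true ∷ T)  eq = cong (true ∷_) (eqVecBool-sound S T eq)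
eqVecBool-sound (false ∷ S) (false ∷ T) eq = cong (false ∷_) (eqVecBool-sound S T eq)
eqVecBool-sound (true ∷ S)  (false ∷ T) ()
eqVecBool-sound (false ∷ S) (true ∷ T)  ()

σ-mon : ∀ {N} (S₀ : Vec Bool N) α₀ → σ (mon (mono S₀ α₀)) ≈ negPow (countT S₀) ·ₛ mon (mono S₀ α₀)
σ-mon S₀ α₀ (mono S α) with eqVecBool S₀ S in S₀≟S | eqVecℕ α₀ α
... | false | _     = trans (ℤP.*-zeroʳ (negPow (countT S))) (sym (ℤP.*-zeroʳ (negPow (countT S₀))))
... | true  | false = trans (ℤP.*-zeroʳ (negPow (countT S))) (sym (ℤP.*-zeroʳ (negPow (countT S₀))))
... | true  | true  rewrite eqVecBool-sound S₀ S S₀≟S = refl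

1ₛ : ∀ {N} → SPoly N
1ₛ {N} = mon (mono (V.replicate N false) (V.replicate N 0))

countT-replicate : ∀ N → countT (V.replicate N false) ≡ 0
countT-replicate zero    = refl
countT-replicate (suc N) = countT-replicate N

σ-θ-free-mon : ∀ {N} (α₀ : Vec ℕ N) → σ (mon (mono (V.replicate N false) α₀)) ≈ mon (mono (V.replicate N false) α₀)
σ-θ-free-mon {N} α₀ m = trans (σ-mon (V.replicate N false) α₀ m)
  (trans (cong (λ c → negPow c * mon (mono (V.replicate N false) α₀) m) (countT-replicate N)) (ℤP.*-identityˡ _))

-- Sequences and the Cauchy product

Seq : ℕ → Set
Seq N = ℕ → SPoly N

infix 4 _≋_
_≋_ : ∀ {N} → Seq N → Seq N → Set
A ≋ B = ∀ n → A n ≈ B n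

≋-setoid : ℕ → Setoid _ _
≋-setoid N = record
  { Carrier       = Seq N
  ; _≈_           = _≋_
  ; isEquivalence = record
    { refl  = λ _ _ → refl
    ; sym   = λ A≋B n m → sym (A≋B n m)
    ; trans = λ A≋B B≋C n m → trans (A≋B n m) (B≋C n m)
    }
  }

module ≋-Reasoning {N} = SetoidReasoning (≋-setoid N)

≋-refl : ∀ {N} {A : Seq N} → A ≋ A
≋-refl _ _ = refl

≋-sym : ∀ {N} {A B : Seq N} → A ≋ B → B ≋ A
≋-sym A≋B n = ≈-sym (A≋B n)

≋-trans : ∀ {N} {A B C : Seq N} → A ≋ B → B ≋ C → A ≋ C
≋-trans A≋B B≋C n = ≈-trans (A≋B n) (B≋C n)

𝟘 : ∀ {N} → Seq N
𝟘 _ = 0ₛ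

infixl 6 _⊕_
_⊕_ : ∀ {N} → Seq N → Seq N → Seq N
(A ⊕ B) n = A n +ₛ B n

infixl 7 _⊙_
_⊙_ : ∀ {N} → ℤ → Seq N → Seq N
(c ⊙ A) n = c ·ₛ A n

-- ν is the Euler operator t d/dt on generating functions Σ Aₙ tⁿ.
ν : ∀ {N} → Seq N → Seq N
ν A n = (+ n) ·ₛ A n

𝟙 : ∀ {N} → Seq N
𝟙 zero    = 1ₛ
𝟙 (suc _) = 0ₛ

-- shift a is multiplication by tᵃ: shift a A n = A (n - a), and 0 for n < a.
shift : ∀ {N} → ℕ → Seq N → Seq N
shift zero    A n       = A n
shift (suc a) A zero    = 0ₛ
shift (suc a) A (suc n) = shift a A n

-- ⨁ and ⋆ are opaque: a sum over a symbolic range must not unfold during unification.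
opaque
  ⨁ : ∀ {N} → ℕ → (ℕ → Seq N) → Seq N
  ⨁ a F n = ∑ a (λ k → F k n)

  ⨁-at : ∀ {N} a (F : ℕ → Seq N) n → ⨁ a F n ≈ ∑ a (λ k → F k n)
  ⨁-at a F n = ≈-refl

  ⨁-suc : ∀ {N} a (F : ℕ → Seq N) → ⨁ (suc a) F ≋ F 0 ⊕ ⨁ a (F ∘ suc)
  ⨁-suc a F n = ≈-refl

  ⨁-cong : ∀ {N} a {F G : ℕ → Seq N} → (∀ k → k < a → F k ≋ G k) → ⨁ a F ≋ ⨁ a G
  ⨁-cong a F≋G n = ∑-cong a (λ k k<a → F≋G k k<a n)

  ⨁-zero : ∀ {N} a {F : ℕ → Seq N} → (∀ k → k < a → F k ≋ 𝟘) → ⨁ a F ≋ 𝟘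
  ⨁-zero a F≋𝟘 n = ∑-zero a (λ k k<a → F≋𝟘 k k<a n)

≋-by-slices : ∀ {N} {A B : Seq (suc N)} → (∀ b a → slice b a ∘ A ≋ slice b a ∘ B) → A ≋ B
≋-by-slices A≋B n = ≈-by-slices (λ b a → A≋B b a n)

⊕-cong : ∀ {N} {A A′ B B′ : Seq N} → A ≋ A′ → B ≋ B′ → A ⊕ B ≋ A′ ⊕ B′
⊕-cong A≋A′ B≋B′ n = +ₛ-cong (A≋A′ n) (B≋B′ n)

⊙-cong : ∀ {N} c {A B : Seq N} → A ≋ B → c ⊙ A ≋ c ⊙ B
⊙-cong c A≋B n = ·ₛ-cong c (A≋B n)

ν-cong : ∀ {N} {A B : Seq N} → A ≋ B → ν A ≋ ν B
ν-cong A≋B n = ·ₛ-cong (+ n) (A≋B n)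

shift-cong : ∀ {N} a {A B : Seq N} → A ≋ B → shift a A ≋ shift a B
shift-cong zero    A≋B n       = A≋B n
shift-cong (suc a) A≋B zero    = ≈-refl
shift-cong (suc a) A≋B (suc n) = shift-cong a A≋B n

shift-⊕ : ∀ {N} a (A B : Seq N) → shift a (A ⊕ B) ≋ shift a A ⊕ shift a B
shift-⊕ zero    A B n       = ≈-refl
shift-⊕ (suc a) A B zero    = ≈-refl
shift-⊕ (suc a) A B (suc n) = shift-⊕ a A B n

shift-⊙ : ∀ {N} a c (A : Seq N) → shift a (c ⊙ A) ≋ c ⊙ shift a A
shift-⊙ zero    c A n       = ≈-refl
shift-⊙ (suc a) c A zero    = ≈-sym (·ₛ-zeroʳ c)
shift-⊙ (suc a) c A (suc n) = shift-⊙ a c A n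

shift-𝟘 : ∀ {N} a → shift a (𝟘 {N}) ≋ 𝟘
shift-𝟘 zero    n       = ≈-refl
shift-𝟘 (suc a) zero    = ≈-refl
shift-𝟘 (suc a) (suc n) = shift-𝟘 a n

shift-shift : ∀ {N} i j (A : Seq N) → shift i (shift j A) ≋ shift (i ℕ.+ j) A
shift-shift zero    j A n       = ≈-refl
shift-shift (suc i) j A zero    = ≈-refl
shift-shift (suc i) j A (suc n) = shift-shift i j A n

shift-shift-∸ : ∀ {N} k a (B : Seq N) → k ≤ a → shift k (shift (a ∸ k) B) ≋ shift a B
shift-shift-∸ k a B k≤a n = ≈-trans (shift-shift k (a ∸ k) B n)
                                    (≈-reflexive (cong (λ j → shift j B n) (ℕP.m+[n∸m]≡n k≤a)))

ν-shift : ∀ {N} a (A : Seq N) → ν (shift a A) ≋ shift a (ν A) ⊕ (+ a) ⊙ shift a A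
ν-shift zero    A n       m = sym (ℤP.+-identityʳ _)
ν-shift (suc a) A zero    m = sym (trans (ℤP.+-identityˡ _) (ℤP.*-zeroʳ (+ suc a)))
ν-shift (suc a) A (suc n) m = step (+ n) (+ a) (shift a A n m) (shift a (ν A) n m) (ν-shift a A n m)
  where
  step : ∀ n a x y → n * x ≡ y + a * x → (1ℤ + n) * x ≡ y + (1ℤ + a) * x
  step n a x y eq = trans (split n x) (trans (cong (_+_ x) eq) (regroup a x y))
    where
    split : ∀ n x → (1ℤ + n) * x ≡ x + n * x
    split = solve-∀
    regroup : ∀ a x y → x + (y + a * x) ≡ y + (1ℤ + a) * x
    regroup = solve-∀

ν-𝟘 : ∀ {N} → ν (𝟘 {N}) ≋ 𝟘
ν-𝟘 n m = ℤP.*-zeroʳ (+ n)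

ν-𝟙 : ∀ {N} → ν (𝟙 {N}) ≋ 𝟘
ν-𝟙 zero    m = ℤP.*-zeroˡ (1ₛ m)
ν-𝟙 (suc n) m = ℤP.*-zeroʳ (+ suc n)

⊕-𝟘 : ∀ {N} (A : Seq N) → A ⊕ 𝟘 ≋ A
⊕-𝟘 A n m = ℤP.+-identityʳ (A n m)

⨁-snoc : ∀ {N} a (F : ℕ → Seq N) → ⨁ (suc a) F ≋ ⨁ a F ⊕ F a
⨁-snoc a F n = ≈-trans (⨁-at (suc a) F n)
  (≈-trans (∑-snoc a (λ k → F k n)) (+ₛ-cong (≈-sym (⨁-at a F n)) ≈-refl))

⨁-empty : ∀ {N} (F : ℕ → Seq N) → ⨁ 0 F ≋ 𝟘
⨁-empty F = ⨁-zero 0 (λ _ ())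

⨁-const : ∀ {N} a (X : Seq N) → ⨁ a (λ _ → X) ≋ (+ a) ⊙ X
⨁-const a X n = ≈-trans (⨁-at a (λ _ → X) n) (∑-const a (X n))

⨁-⊙ : ∀ {N} a (c : ℕ → ℤ) (X : Seq N) → ⨁ a (λ k → c k ⊙ X) ≋ ℤΣ.∑ a c ⊙ X
⨁-⊙ a c X n m = trans (⨁-at a (λ k → c k ⊙ X) n m) (trans (∑-at a (λ k → (c k ⊙ X) n) m) (go a c))
  where
  go : ∀ a c → ℤΣ.∑ a (λ k → c k * X n m) ≡ ℤΣ.∑ a c * X n m
  go zero    c = sym (ℤP.*-zeroˡ (X n m))
  go (suc a) c = trans (cong (_+_ (c 0 * X n m)) (go a (c ∘ suc))) (sym (ℤP.*-distribʳ-+ (X n m) (c 0) _))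

slice-index : ∀ {N} b {i j} (B : Seq (suc N)) → i ≡ j → slice b i ∘ B ≋ slice b j ∘ B
slice-index b B refl = ≋-refl

shift-𝟙 : ∀ {N} k r → shift k (𝟙 {N}) r ≈ χ (r ≡ᵇ k) ·ₛ 1ₛ
shift-𝟙 zero    zero    = ≈-sym (·ₛ-identityˡ 1ₛ)
shift-𝟙 zero    (suc r) m = sym (ℤP.*-zeroˡ (1ₛ m))
shift-𝟙 (suc k) zero    m = sym (ℤP.*-zeroˡ (1ₛ m))
shift-𝟙 (suc k) (suc r) = shift-𝟙 k r

scale-shift-𝟙 : ∀ {N} (c : ℕ → ℤ) k r → c r ·ₛ shift k (𝟙 {N}) r ≈ c k ·ₛ shift k 𝟙 r
scale-shift-𝟙 c zero    zero    = ≈-refl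
scale-shift-𝟙 c zero    (suc r) = ≈-trans (·ₛ-zeroʳ (c (suc r))) (≈-sym (·ₛ-zeroʳ (c 0)))
scale-shift-𝟙 c (suc k) zero    = ≈-trans (·ₛ-zeroʳ (c 0)) (≈-sym (·ₛ-zeroʳ (c (suc k))))
scale-shift-𝟙 c (suc k) (suc r) = scale-shift-𝟙 (c ∘ suc) k r

rearrange : ∀ {N} {X Y U V W : Seq N} → X ⊕ Y ≋ U ⊕ V → (X ⊕ W) ⊕ Y ≋ (U ⊕ W) ⊕ V
rearrange {X = X} {Y} {U} {V} {W} eq n m = begin
  X n m + W n m + Y n m     ≡⟨ swap (X n m) (W n m) (Y n m) ⟩
  X n m + Y n m + W n m     ≡⟨ cong (_+ W n m) (eq n m) ⟩
  U n m + V n m + W n m     ≡⟨ swap (U n m) (V n m) (W n m) ⟩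
  U n m + W n m + V n m     ∎
  where
  open ≡-Reasoning
  swap : ∀ x y z → x + y + z ≡ x + z + y
  swap = solve-∀

slice-1ₛ-false : ∀ {N} a → slice false a (1ₛ {suc N}) ≈ 𝟙 a
slice-1ₛ-false {N} zero    m = trans (slice-mon false 0 false 0 (V.replicate N false) (V.replicate N 0) m) (ℤP.*-identityˡ _)
slice-1ₛ-false {N} (suc a) m = trans (slice-mon false (suc a) false 0 (V.replicate N false) (V.replicate N 0) m) (ℤP.*-zeroˡ (1ₛ {N} m))

slice-1ₛ-true : ∀ {N} a → slice true a (1ₛ {suc N}) ≈ 0ₛ
slice-1ₛ-true {N} a m = trans (slice-mon true a false 0 (V.replicate N false) (V.replicate N 0) m) (ℤP.*-zeroˡ (1ₛ {N} m))

σ-𝟙 : ∀ {N} k → σ (𝟙 {N} k) ≈ 𝟙 k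
σ-𝟙 {N} zero = σ-θ-free-mon (V.replicate N 0)
σ-𝟙 (suc k) (mono S α) = ℤP.*-zeroʳ (negPow (countT S))

private
  ∑-𝟙 : ∀ {N} → (∀ (f : SPoly N) → 1ₛ *ₛ f ≈ f) → ∀ a (F : ℕ → SPoly N) → ∑ (suc a) (λ k → 𝟙 k *ₛ F k) ≈ F 0
  ∑-𝟙 unit a F = ≈-trans (+ₛ-cong (unit (F 0)) (∑-zero a (λ k _ → *ₛ-zeroˡ (F (suc k))))) (λ m → ℤP.+-identityʳ (F 0 m))

1ₛ-*ₛ : ∀ {N} (g : SPoly N) → 1ₛ *ₛ g ≈ g
1ₛ-*ₛ {zero} g (mono [] []) = unit (g (mono [] []))
  where
  unit : ∀ x → 1ℤ * (1ℤ * x) + 0ℤ ≡ x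
  unit = solve-∀
1ₛ-*ₛ {suc N} g = ≈-by-slices slices
  where
  open ≈-Reasoning
  slices : ∀ b a → slice b a (1ₛ *ₛ g) ≈ slice b a g
  slices false a = begin
    slice false a (1ₛ *ₛ g)                                      ≈⟨ slice-*ₛ-false a 1ₛ g ⟩
    ∑ (suc a) (λ k → slice false k 1ₛ *ₛ slice false (a ∸ k) g) ≈⟨ ∑-cong (suc a) {f = λ k → slice false k 1ₛ *ₛ slice false (a ∸ k) g} {g = λ k → 𝟙 k *ₛ slice false (a ∸ k) g}
                                                                        (λ k _ → *ₛ-cong (slice-1ₛ-false k) ≈-refl) ⟩
    ∑ (suc a) (λ k → 𝟙 k *ₛ slice false (a ∸ k) g)             ≈⟨ ∑-𝟙 1ₛ-*ₛ a (λ k → slice false (a ∸ k) g) ⟩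
    slice false a g                                              ∎
  slices true a = begin
    slice true a (1ₛ *ₛ g)
      ≈⟨ slice-*ₛ-true a 1ₛ g ⟩
    ∑ (suc a) (λ k → slice true k 1ₛ *ₛ slice false (a ∸ k) g +ₛ σ (slice false k 1ₛ) *ₛ slice true (a ∸ k) g)
      ≈⟨ ∑-cong (suc a) {f = λ k → slice true k 1ₛ *ₛ slice false (a ∸ k) g +ₛ σ (slice false k 1ₛ) *ₛ slice true (a ∸ k) g}
                        {g = λ k → 𝟙 k *ₛ slice true (a ∸ k) g} (λ k _ → ≈-trans (+ₛ-cong (≈-trans (*ₛ-cong {g = slice false (a ∸ k) g} (slice-1ₛ-true k) ≈-refl) (*ₛ-zeroˡ (slice false (a ∸ k) g)))
                                                   (*ₛ-cong (≈-trans (σ-cong (slice-1ₛ-false k)) (σ-𝟙 k)) ≈-refl))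
                                          (λ m → ℤP.+-identityˡ ((𝟙 k *ₛ slice true (a ∸ k) g) m))) ⟩
    ∑ (suc a) (λ k → 𝟙 k *ₛ slice true (a ∸ k) g)
      ≈⟨ ∑-𝟙 1ₛ-*ₛ a (λ k → slice true (a ∸ k) g) ⟩
    slice true a g ∎

infixl 7 _⋆_

opaque
  _⋆_ : ∀ {N} → Seq N → Seq N → Seq N
  (A ⋆ B) n = ∑ (suc n) (λ r → A r *ₛ B (n ∸ r))

  ⋆-at : ∀ {N} (A B : Seq N) n → (A ⋆ B) n ≈ ∑ (suc n) (λ r → A r *ₛ B (n ∸ r))
  ⋆-at A B n = ≈-refl

  ⋆-cong : ∀ {N} {A A′ B B′ : Seq N} → A ≋ A′ → B ≋ B′ → A ⋆ B ≋ A′ ⋆ B′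
  ⋆-cong A≋A′ B≋B′ n = ∑-cong (suc n) (λ r _ → *ₛ-cong (A≋A′ r) (B≋B′ (n ∸ r)))

  𝟙-⋆ : ∀ {N} (B : Seq N) → 𝟙 ⋆ B ≋ B
  𝟙-⋆ B n = ∑-𝟙 1ₛ-*ₛ n (λ r → B (n ∸ r))

  𝟘-⋆ : ∀ {N} (B : Seq N) → 𝟘 ⋆ B ≋ 𝟘
  𝟘-⋆ B n = ∑-zero (suc n) (λ r _ → *ₛ-zeroˡ (B (n ∸ r)))

  ⋆-𝟘 : ∀ {N} (A : Seq N) → A ⋆ 𝟘 ≋ 𝟘
  ⋆-𝟘 A n = ∑-zero (suc n) (λ r _ → *ₛ-zeroʳ (A r))

  ⊙-⋆ : ∀ {N} c (A B : Seq N) → (c ⊙ A) ⋆ B ≋ c ⊙ (A ⋆ B)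
  ⊙-⋆ c A B n = ≈-trans (∑-cong (suc n) (λ r _ → ·ₛ-*ₛ c (A r) (B (n ∸ r))))
                        (≈-sym (·ₛ-∑ c (suc n) (λ r → A r *ₛ B (n ∸ r))))

  ⋆-⊙ : ∀ {N} c (A B : Seq N) → A ⋆ (c ⊙ B) ≋ c ⊙ (A ⋆ B)
  ⋆-⊙ c A B n = ≈-trans (∑-cong (suc n) (λ r _ → *ₛ-·ₛ c (A r) (B (n ∸ r))))
                        (≈-sym (·ₛ-∑ c (suc n) (λ r → A r *ₛ B (n ∸ r))))

  shift-⋆ : ∀ {N} a (A B : Seq N) → shift a A ⋆ B ≋ shift a (A ⋆ B)
  shift-⋆ zero    A B n       = ≈-refl
  shift-⋆ (suc a) A B zero    = +ₛ-cong (*ₛ-zeroˡ (B 0)) ≈-refl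
  shift-⋆ (suc a) A B (suc n) =
    ≈-trans (+ₛ-cong (*ₛ-zeroˡ (B (suc n))) (shift-⋆ a A B n)) (λ m → ℤP.+-identityˡ (shift a (A ⋆ B) n m))

  ⋆-shift : ∀ {N} a (A B : Seq N) → A ⋆ shift a B ≋ shift a (A ⋆ B)
  ⋆-shift zero    A B     = λ n → ≈-refl
  ⋆-shift {N} (suc a) A B = begin
    A ⋆ shift (suc a) B          ≈⟨ ⋆-cong {A = A} (λ _ → ≈-refl) (≋-sym (shift-shift 1 a B)) ⟩
    A ⋆ shift 1 (shift a B)      ≈⟨ ⋆-shift₁ (shift a B) ⟩
    shift 1 (A ⋆ shift a B)      ≈⟨ shift-cong 1 (⋆-shift a A B) ⟩
    shift 1 (shift a (A ⋆ B))    ≈⟨ shift-shift 1 a (A ⋆ B) ⟩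
    shift (suc a) (A ⋆ B)        ∎
    where
    open ≋-Reasoning
    ⋆-shift₁ : ∀ C → A ⋆ shift 1 C ≋ shift 1 (A ⋆ C)
    ⋆-shift₁ C zero    = +ₛ-cong (*ₛ-zeroʳ (A 0)) ≈-refl
    ⋆-shift₁ C (suc n) = ≈-trans (∑-snoc (suc n) F)
      (≈-trans (+ₛ-cong (∑-cong (suc n) {g = λ r → A r *ₛ C (n ∸ r)} body) last) (λ m → ℤP.+-identityʳ ((A ⋆ C) n m)))
      where
      F : ℕ → SPoly N
      F r = A r *ₛ shift 1 C (suc n ∸ r)
      body : ∀ r → r < suc n → F r ≈ A r *ₛ C (n ∸ r)
      body r r<1+n = ≈-reflexive (cong (λ j → A r *ₛ shift 1 C j) (ℕP.+-∸-assoc 1 (ℕP.≤-pred r<1+n)))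
      last : F (suc n) ≈ 0ₛ
      last = ≈-trans (≈-reflexive (cong (λ j → A (suc n) *ₛ shift 1 C j) (ℕP.n∸n≡0 n))) (*ₛ-zeroʳ (A (suc n)))

  slice-⋆-false : ∀ {N} a (A B : Seq (suc N)) →
    slice false a ∘ (A ⋆ B) ≋ ⨁ (suc a) (λ k → (slice false k ∘ A) ⋆ (slice false (a ∸ k) ∘ B))
  slice-⋆-false a A B n = begin
    slice false a (∑ (suc n) (λ r → A r *ₛ B (n ∸ r)))
      ≈⟨ slice-∑ false a (suc n) (λ r → A r *ₛ B (n ∸ r)) ⟩
    ∑ (suc n) (λ r → slice false a (A r *ₛ B (n ∸ r)))
      ≈⟨ ∑-cong (suc n) (λ r _ → slice-*ₛ-false a (A r) (B (n ∸ r))) ⟩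
    ∑ (suc n) (λ r → ∑ (suc a) (λ k → slice false k (A r) *ₛ slice false (a ∸ k) (B (n ∸ r))))
      ≈⟨ ∑-swap (suc n) (suc a) (λ r k → slice false k (A r) *ₛ slice false (a ∸ k) (B (n ∸ r))) ⟩
    ∑ (suc a) (λ k → ((slice false k ∘ A) ⋆ (slice false (a ∸ k) ∘ B)) n)
      ≈⟨ ≈-sym (⨁-at (suc a) (λ k → (slice false k ∘ A) ⋆ (slice false (a ∸ k) ∘ B)) n) ⟩
    ⨁ (suc a) (λ k → (slice false k ∘ A) ⋆ (slice false (a ∸ k) ∘ B)) n ∎
    where open ≈-Reasoning

  slice-⋆-true : ∀ {N} a (A B : Seq (suc N)) →
    slice true a ∘ (A ⋆ B)
      ≋ ⨁ (suc a) (λ k → (slice true k ∘ A) ⋆ (slice false (a ∸ k) ∘ B) ⊕ (σ ∘ slice false k ∘ A) ⋆ (slice true (a ∸ k) ∘ B))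
  slice-⋆-true {N} a A B n = begin
    slice true a (∑ (suc n) (λ r → A r *ₛ B (n ∸ r)))
      ≈⟨ slice-∑ true a (suc n) (λ r → A r *ₛ B (n ∸ r)) ⟩
    ∑ (suc n) (λ r → slice true a (A r *ₛ B (n ∸ r)))
      ≈⟨ ∑-cong (suc n) {g = λ r → ∑ (suc a) (λ k → X k r +ₛ Y k r)} (λ r _ → slice-*ₛ-true a (A r) (B (n ∸ r))) ⟩
    ∑ (suc n) (λ r → ∑ (suc a) (λ k → X k r +ₛ Y k r))
      ≈⟨ ∑-swap (suc n) (suc a) (λ r k → X k r +ₛ Y k r) ⟩
    ∑ (suc a) (λ k → ∑ (suc n) (λ r → X k r +ₛ Y k r))
      ≈⟨ ∑-cong (suc a) (λ k _ → ∑-∙ (suc n) (X k) (Y k)) ⟩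
    ∑ (suc a) (λ k → ((slice true k ∘ A) ⋆ (slice false (a ∸ k) ∘ B) ⊕ (σ ∘ slice false k ∘ A) ⋆ (slice true (a ∸ k) ∘ B)) n)
      ≈⟨ ≈-sym (⨁-at (suc a) (λ k → (slice true k ∘ A) ⋆ (slice false (a ∸ k) ∘ B) ⊕ (σ ∘ slice false k ∘ A) ⋆ (slice true (a ∸ k) ∘ B)) n) ⟩
    ⨁ (suc a) (λ k → (slice true k ∘ A) ⋆ (slice false (a ∸ k) ∘ B) ⊕ (σ ∘ slice false k ∘ A) ⋆ (slice true (a ∸ k) ∘ B)) n ∎
    where
    open ≈-Reasoning
    X Y : ℕ → ℕ → SPoly N
    X k r = slice true k (A r) *ₛ slice false (a ∸ k) (B (n ∸ r))
    Y k r = σ (slice false k (A r)) *ₛ slice true (a ∸ k) (B (n ∸ r))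

monomial-⋆ : ∀ {N} c k (C : Seq N) → (c ⊙ shift k 𝟙) ⋆ C ≋ c ⊙ shift k C
monomial-⋆ c k C = begin
  (c ⊙ shift k 𝟙) ⋆ C   ≈⟨ ⊙-⋆ c (shift k 𝟙) C ⟩
  c ⊙ (shift k 𝟙 ⋆ C)   ≈⟨ ⊙-cong c (shift-⋆ k 𝟙 C) ⟩
  c ⊙ shift k (𝟙 ⋆ C)   ≈⟨ ⊙-cong c (shift-cong k (𝟙-⋆ C)) ⟩
  c ⊙ shift k C         ∎
  where open ≋-Reasoning

-- A r = A′ r + c r x₀ʳ, and A involves no θ.
record PowerSumLike {N} (A : Seq (suc N)) (A′ : Seq N) (c : ℕ → ℤ) : Set where
  field
    slice-x⁰    : slice false 0 ∘ A ≋ A′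
    slice-xˢᵘᶜ  : ∀ k → slice false (suc k) ∘ A ≋ c (suc k) ⊙ shift (suc k) 𝟙
    slice-θ     : ∀ k → slice true k ∘ A ≋ 𝟘
    σ-invariant : ∀ r → σ (A r) ≈ A r

-- A r = A′ r + d r θ₀ x₀ʳ.
record FermionSumLike {N} (A : Seq (suc N)) (A′ : Seq N) (d : ℕ → ℤ) : Set where
  field
    slice-x⁰   : slice false 0 ∘ A ≋ A′
    slice-xˢᵘᶜ : ∀ k → slice false (suc k) ∘ A ≋ 𝟘
    slice-θ    : ∀ k → slice true k ∘ A ≋ d k ⊙ shift k 𝟙

-- B n = B′ n + x₀ B′ (n - 1) + (terms containing θ₀).
record ElementaryLike {N} (B : Seq (suc N)) (B′ : Seq N) : Set where
  field
    slice-x⁰ : slice false 0 ∘ B ≋ B′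
    slice-x¹ : slice false 1 ∘ B ≋ shift 1 B′
    slice-x² : ∀ k → slice false (suc (suc k)) ∘ B ≋ 𝟘

module _ {N} {A : Seq (suc N)} {A′ : Seq N} {c : ℕ → ℤ} (A-like : PowerSumLike A A′ c) where

  open PowerSumLike A-like
  open ≋-Reasoning

  private
    expand : ∀ a (C : ℕ → Seq N) →
      ⨁ (suc a) (λ k → (slice false k ∘ A) ⋆ C (a ∸ k))
        ≋ A′ ⋆ C a ⊕ ⨁ a (λ k → c (suc k) ⊙ shift (suc k) (C (a ∸ suc k)))
    expand a C = ≋-trans (⨁-suc a (λ k → (slice false k ∘ A) ⋆ C (a ∸ k))) (⊕-cong (⋆-cong slice-x⁰ (λ _ → ≈-refl))
      (⨁-cong a (λ k _ → ≋-trans (⋆-cong (slice-xˢᵘᶜ k) (λ _ → ≈-refl)) (monomial-⋆ (c (suc k)) (suc k) (C (a ∸ suc k))))))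

  slice-powerSum-⋆ : ∀ b a (B : Seq (suc N)) →
    slice b a ∘ (A ⋆ B) ≋ A′ ⋆ (slice b a ∘ B) ⊕ ⨁ a (λ k → c (suc k) ⊙ shift (suc k) (slice b (a ∸ suc k) ∘ B))
  slice-powerSum-⋆ false a B = ≋-trans (slice-⋆-false a A B) (expand a (λ j → slice false j ∘ B))
  slice-powerSum-⋆ true  a B = begin
    slice true a ∘ (A ⋆ B)
      ≈⟨ slice-⋆-true a A B ⟩
    ⨁ (suc a) (λ k → (slice true k ∘ A) ⋆ (slice false (a ∸ k) ∘ B) ⊕ (σ ∘ slice false k ∘ A) ⋆ (slice true (a ∸ k) ∘ B))
      ≈⟨ ⨁-cong (suc a) (λ k _ → ≋-trans (⊕-cong (≋-trans (⋆-cong (slice-θ k) (λ _ → ≈-refl)) (𝟘-⋆ _))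
                                                  (⋆-cong {A = σ ∘ slice false k ∘ A} {B = slice true (a ∸ k) ∘ B} (λ r → slice-cong false k (σ-invariant r)) (λ _ → ≈-refl)))
                                         (λ n m → ℤP.+-identityˡ _)) ⟩
    ⨁ (suc a) (λ k → (slice false k ∘ A) ⋆ (slice true (a ∸ k) ∘ B))
      ≈⟨ expand a (λ j → slice true j ∘ B) ⟩
    A′ ⋆ (slice true a ∘ B) ⊕ ⨁ a (λ k → c (suc k) ⊙ shift (suc k) (slice true (a ∸ suc k) ∘ B)) ∎

  slice-θ-powerSum-⋆ : ∀ a (B : Seq (suc N)) → (∀ k → slice true k ∘ B ≋ 𝟘) → slice true a ∘ (A ⋆ B) ≋ 𝟘
  slice-θ-powerSum-⋆ a B B-θ-free = begin
    slice true a ∘ (A ⋆ B)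
      ≈⟨ slice-powerSum-⋆ true a B ⟩
    A′ ⋆ (slice true a ∘ B) ⊕ ⨁ a (λ k → c (suc k) ⊙ shift (suc k) (slice true (a ∸ suc k) ∘ B))
      ≈⟨ ⊕-cong (≋-trans (⋆-cong (λ _ → ≈-refl) (B-θ-free a)) (⋆-𝟘 A′))
                (⨁-zero a (λ k _ n → ≈-trans (·ₛ-cong (c (suc k)) (≈-trans (shift-cong (suc k) (B-θ-free (a ∸ suc k)) n)
                                                                            (shift-𝟘 (suc k) n)))
                                             (·ₛ-zeroʳ (c (suc k))))) ⟩
    𝟘 ⊕ 𝟘
      ≈⟨ (λ n m → refl) ⟩
    𝟘 ∎

module _ {N} {A : Seq (suc N)} {A′ : Seq N} {d : ℕ → ℤ} (A-like : FermionSumLike A A′ d) where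

  open FermionSumLike A-like
  open ≋-Reasoning

  slice-false-fermionSum-⋆ : ∀ a (B : Seq (suc N)) → slice false a ∘ (A ⋆ B) ≋ A′ ⋆ (slice false a ∘ B)
  slice-false-fermionSum-⋆ a B = begin
    slice false a ∘ (A ⋆ B)
      ≈⟨ slice-⋆-false a A B ⟩
    ⨁ (suc a) (λ k → (slice false k ∘ A) ⋆ (slice false (a ∸ k) ∘ B))
      ≈⟨ ⨁-suc a (λ k → (slice false k ∘ A) ⋆ (slice false (a ∸ k) ∘ B)) ⟩
    (slice false 0 ∘ A) ⋆ (slice false a ∘ B) ⊕ ⨁ a (λ k → (slice false (suc k) ∘ A) ⋆ (slice false (a ∸ suc k) ∘ B))
      ≈⟨ ⊕-cong (⋆-cong slice-x⁰ (λ _ → ≈-refl)) (⨁-zero a (λ k _ → ≋-trans (⋆-cong (slice-xˢᵘᶜ k) (λ _ → ≈-refl)) (𝟘-⋆ _))) ⟩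
    A′ ⋆ (slice false a ∘ B) ⊕ 𝟘
      ≈⟨ (λ n m → ℤP.+-identityʳ _) ⟩
    A′ ⋆ (slice false a ∘ B) ∎

  slice-true-fermionSum-⋆ : ∀ a (B : Seq (suc N)) → (∀ k → slice true k ∘ B ≋ 𝟘) →
    slice true a ∘ (A ⋆ B) ≋ ⨁ (suc a) (λ k → d k ⊙ shift k (slice false (a ∸ k) ∘ B))
  slice-true-fermionSum-⋆ a B B-θ-free = begin
    slice true a ∘ (A ⋆ B)
      ≈⟨ slice-⋆-true a A B ⟩
    ⨁ (suc a) (λ k → (slice true k ∘ A) ⋆ (slice false (a ∸ k) ∘ B) ⊕ (σ ∘ slice false k ∘ A) ⋆ (slice true (a ∸ k) ∘ B))
      ≈⟨ ⨁-cong (suc a) (λ k _ → ≋-trans (⊕-cong (≋-trans (⋆-cong (slice-θ k) (λ _ → ≈-refl)) (monomial-⋆ (d k) k _))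
                                                  (≋-trans (⋆-cong (λ _ → ≈-refl) (B-θ-free (a ∸ k))) (⋆-𝟘 _)))
                                         (λ n m → ℤP.+-identityʳ _)) ⟩
    ⨁ (suc a) (λ k → d k ⊙ shift k (slice false (a ∸ k) ∘ B)) ∎

private
  reassoc : ∀ w c x → w * (c * x) ≡ (w * c) * x
  reassoc w c x = sym (ℤP.*-assoc w c x)

powerSumLike-scale : ∀ {N} {A : Seq (suc N)} {A′ : Seq N} {c : ℕ → ℤ} (w : ℕ → ℤ) → PowerSumLike A A′ c →
  PowerSumLike (λ r → w r ·ₛ A r) (λ r → w r ·ₛ A′ r) (λ k → w k * c k)
powerSumLike-scale {A = A} {c = c} w A-like = record
  { slice-x⁰    = λ r → ·ₛ-cong (w r) (slice-x⁰ r)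
  ; slice-xˢᵘᶜ  = λ k r → ≈-trans (·ₛ-cong (w r) (slice-xˢᵘᶜ k r))
      (λ m → trans (reassoc (w r) (c (suc k)) _) (scale-shift-𝟙 (λ j → w j * c (suc k)) (suc k) r m))
  ; slice-θ     = λ k r → ≈-trans (·ₛ-cong (w r) (slice-θ k r)) (·ₛ-zeroʳ (w r))
  ; σ-invariant = λ r → λ { (mono S α) → trans (commute (negPow (countT S)) (w r) (A r (mono S α)))
                                                (cong (w r *_) (σ-invariant r (mono S α))) }
  }
  where
  open PowerSumLike A-like
  commute : ∀ s w x → s * (w * x) ≡ w * (s * x)
  commute = solve-∀

fermionSumLike-scale : ∀ {N} {A : Seq (suc N)} {A′ : Seq N} {d : ℕ → ℤ} (w : ℕ → ℤ) → FermionSumLike A A′ d →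
  FermionSumLike (λ r → w r ·ₛ A r) (λ r → w r ·ₛ A′ r) (λ k → w k * d k)
fermionSumLike-scale {d = d} w A-like = record
  { slice-x⁰   = λ r → ·ₛ-cong (w r) (slice-x⁰ r)
  ; slice-xˢᵘᶜ = λ k r → ≈-trans (·ₛ-cong (w r) (slice-xˢᵘᶜ k r)) (·ₛ-zeroʳ (w r))
  ; slice-θ    = λ k r → ≈-trans (·ₛ-cong (w r) (slice-θ k r))
      (λ m → trans (reassoc (w r) (d k) _) (scale-shift-𝟙 (λ j → w j * d k) k r m))
  }
  where open FermionSumLike A-like

-- Power sums

private
  tabulate-const : ∀ {A : Set} n (x : A) → V.tabulate {n = n} (λ _ → x) ≡ V.replicate n x
  tabulate-const zero    x = refl
  tabulate-const (suc n) x = cong (x ∷_) (tabulate-const n x)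

  ⌊suc≟suc⌋ : ∀ {N} (i j : Fin N) → ⌊ Fin.suc i ≟ suc j ⌋ ≡ ⌊ i ≟ j ⌋
  ⌊suc≟suc⌋ i j = ⌊⌋-map′ (cong suc) FinP.suc-injective (i ≟ j)

  powAt-zero : ∀ {N} k → powAt {suc N} zero k ≡ k ∷ V.replicate N 0
  powAt-zero {N} k = cong (k ∷_) (tabulate-const N 0)

  powAt-suc : ∀ {N} (i : Fin N) k → powAt (suc i) k ≡ 0 ∷ powAt i k
  powAt-suc i k = cong (0 ∷_) (VP.tabulate-cong (λ j → cong (λ b → if b then k else 0) (⌊suc≟suc⌋ i j)))

  single-zero : ∀ {N} → single {suc N} zero ≡ true ∷ V.replicate N false
  single-zero {N} = cong (true ∷_) (tabulate-const N false)

  single-suc : ∀ {N} (i : Fin N) → single (suc i) ≡ false ∷ single i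
  single-suc i = cong (false ∷_) (VP.tabulate-cong (⌊suc≟suc⌋ i))

slice-p : ∀ {N} b a r →
  slice b a (p {suc N} (suc r)) ≈ χ (not b ∧ (suc r ≡ᵇ a)) ·ₛ 1ₛ +ₛ χ (not b ∧ (0 ≡ᵇ a)) ·ₛ p (suc r)
slice-p {N} b a r = begin
  slice b a (ΣL (allFin (suc N)) P)
    ≈⟨ slice-cong b a (ΣL-allFin-suc P) ⟩
  slice b a (P zero) +ₛ slice b a (ΣL (allFin N) (P ∘ suc))
    ≈⟨ +ₛ-cong head (≈-trans (slice-ΣL b a (allFin N) (P ∘ suc)) (≈-trans tail (ΣL-·ₛ (χ (not b ∧ (0 ≡ᵇ a))) (allFin N) P′))) ⟩
  χ (not b ∧ (suc r ≡ᵇ a)) ·ₛ 1ₛ +ₛ χ (not b ∧ (0 ≡ᵇ a)) ·ₛ p (suc r) ∎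
  where
  open ≈-Reasoning
  P : Fin (suc N) → SPoly (suc N)
  P i = mon (mono (V.replicate (suc N) false) (powAt i (suc r)))
  P′ : Fin N → SPoly N
  P′ i = mon (mono (V.replicate N false) (powAt i (suc r)))
  head : slice b a (P zero) ≈ χ (not b ∧ (suc r ≡ᵇ a)) ·ₛ 1ₛ
  head = ≈-trans (≈-reflexive (cong (λ α → slice b a (mon (mono (V.replicate (suc N) false) α))) (powAt-zero (suc r))))
                 (slice-mon b a false (suc r) (V.replicate N false) (V.replicate N 0))
  tail : ΣL (allFin N) (slice b a ∘ P ∘ suc) ≈ ΣL (allFin N) (λ i → χ (not b ∧ (0 ≡ᵇ a)) ·ₛ P′ i)
  tail = PolySums.sumList-cong (allFin N) (λ i →
    ≈-trans (≈-reflexive (cong (λ α → slice b a (mon (mono (V.replicate (suc N) false) α))) (powAt-suc i (suc r))))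
            (slice-mon b a false 0 (V.replicate N false) (powAt i (suc r))))

slice-p~ : ∀ {N} b a r →
  slice b a (p~ {suc N} r) ≈ χ (b ∧ (r ≡ᵇ a)) ·ₛ 1ₛ +ₛ χ (not b ∧ (0 ≡ᵇ a)) ·ₛ p~ r
slice-p~ {N} b a r = begin
  slice b a (ΣL (allFin (suc N)) P)
    ≈⟨ slice-cong b a (ΣL-allFin-suc P) ⟩
  slice b a (P zero) +ₛ slice b a (ΣL (allFin N) (P ∘ suc))
    ≈⟨ +ₛ-cong head (≈-trans (slice-ΣL b a (allFin N) (P ∘ suc)) (≈-trans tail (ΣL-·ₛ (χ (not b ∧ (0 ≡ᵇ a))) (allFin N) P′))) ⟩
  χ (b ∧ (r ≡ᵇ a)) ·ₛ 1ₛ +ₛ χ (not b ∧ (0 ≡ᵇ a)) ·ₛ p~ r ∎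
  where
  open ≈-Reasoning
  P : Fin (suc N) → SPoly (suc N)
  P i = mon (mono (single i) (powAt i r))
  P′ : Fin N → SPoly N
  P′ i = mon (mono (single i) (powAt i r))
  head : slice b a (P zero) ≈ χ (b ∧ (r ≡ᵇ a)) ·ₛ 1ₛ
  head = ≈-trans (≈-reflexive (cong₂ (λ S α → slice b a (mon (mono S α))) single-zero (powAt-zero r)))
                 (slice-mon b a true r (V.replicate N false) (V.replicate N 0))
  tail : ΣL (allFin N) (slice b a ∘ P ∘ suc) ≈ ΣL (allFin N) (λ i → χ (not b ∧ (0 ≡ᵇ a)) ·ₛ P′ i)
  tail = PolySums.sumList-cong (allFin N) (λ i →
    ≈-trans (≈-reflexive (cong₂ (λ S α → slice b a (mon (mono S α))) (single-suc i) (powAt-suc i r)))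
            (slice-mon b a false 0 (single i) (powAt i r)))

private
  keep-first : ∀ x y → 1ℤ * x + 0ℤ * y ≡ x
  keep-first = solve-∀
  keep-first-scaled : ∀ c x y → c * x + 0ℤ * y ≡ c * x
  keep-first-scaled = solve-∀
  keep-second : ∀ x y → 0ℤ * x + 1ℤ * y ≡ y
  keep-second = solve-∀
  keep-none : ∀ x y → 0ℤ * x + 0ℤ * y ≡ 0ℤ
  keep-none = solve-∀

p-powerSumLike : ∀ {N} → PowerSumLike (p {suc N}) p (λ _ → 1ℤ)
p-powerSumLike {N} = record
  { slice-x⁰    = λ { zero → ≈-refl ; (suc r) → ≈-trans (slice-p false 0 r) (λ m → keep-second (1ₛ m) (p (suc r) m)) }
  ; slice-xˢᵘᶜ  = λ k → λ { zero    → ≈-sym (·ₛ-zeroʳ 1ℤ)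
                          ; (suc r) → ≈-trans (slice-p false (suc k) r)
                                        (λ m → trans (keep-first-scaled (χ (r ≡ᵇ k)) (1ₛ m) (p (suc r) m))
                                                     (sym (trans (ℤP.*-identityˡ _) (shift-𝟙 k r m)))) }
  ; slice-θ     = λ k → λ { zero → ≈-refl ; (suc r) → ≈-trans (slice-p true k r) (λ m → keep-none (1ₛ m) (p (suc r) m)) }
  ; σ-invariant = λ { zero    → λ { (mono S α) → ℤP.*-zeroʳ (negPow (countT S)) }
                    ; (suc r) → ≈-trans (σ-ΣL (allFin (suc N)) _) (PolySums.sumList-cong (allFin (suc N)) (λ i → σ-θ-free-mon (powAt i (suc r)))) }
  }

p~-fermionSumLike : ∀ {N} → FermionSumLike (p~ {suc N}) p~ (λ _ → 1ℤ)
p~-fermionSumLike = record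
  { slice-x⁰   = λ r → ≈-trans (slice-p~ false 0 r) (λ m → keep-second (1ₛ m) (p~ r m))
  ; slice-xˢᵘᶜ = λ k r → ≈-trans (slice-p~ false (suc k) r) (λ m → keep-none (1ₛ m) (p~ r m))
  ; slice-θ    = λ k r → ≈-trans (slice-p~ true k r)
                   (λ m → trans (keep-first-scaled (χ (r ≡ᵇ k)) (1ₛ m) (p~ r m)) (sym (trans (ℤP.*-identityˡ _) (shift-𝟙 k r m))))
  }

p± : ∀ {N} → Seq N
p± r = negPow (suc r) ·ₛ p r

p~⁺ : ∀ {N} → Seq N
p~⁺ r = (+ suc r) ·ₛ p~ r

p~± : ∀ {N} → Seq N
p~± r = (negPow r * + suc r) ·ₛ p~ r

p±-powerSumLike : ∀ {N} → PowerSumLike (p± {suc N}) p± (λ k → negPow (suc k) * 1ℤ)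
p±-powerSumLike = powerSumLike-scale (λ r → negPow (suc r)) p-powerSumLike

p~⁺-fermionSumLike : ∀ {N} → FermionSumLike (p~⁺ {suc N}) p~⁺ (λ k → + suc k * 1ℤ)
p~⁺-fermionSumLike = fermionSumLike-scale (λ r → + suc r) p~-fermionSumLike

p~±-fermionSumLike : ∀ {N} → FermionSumLike (p~± {suc N}) p~± (λ k → negPow k * + suc k * 1ℤ)
p~±-fermionSumLike = fermionSumLike-scale (λ r → negPow r * + suc r) p~-fermionSumLike

slice-p⋆-shifts : ∀ {N} b (B : Seq (suc N)) (B′ : Seq N) → (∀ j → slice b j ∘ B ≋ shift j B′) →
  ∀ a → slice b a ∘ (p ⋆ B) ≋ shift a (p ⋆ B′) ⊕ (+ a) ⊙ shift a B′
slice-p⋆-shifts b B B′ B-slices a = begin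
  slice b a ∘ (p ⋆ B)
    ≈⟨ slice-powerSum-⋆ p-powerSumLike b a B ⟩
  p ⋆ (slice b a ∘ B) ⊕ ⨁ a (λ k → 1ℤ ⊙ shift (suc k) (slice b (a ∸ suc k) ∘ B))
    ≈⟨ ⊕-cong (≋-trans (⋆-cong ≋-refl (B-slices a)) (⋆-shift a p B′)) (≋-trans (⨁-cong a corrections) (⨁-const a (shift a B′))) ⟩
  shift a (p ⋆ B′) ⊕ (+ a) ⊙ shift a B′ ∎
  where
  open ≋-Reasoning
  corrections : ∀ k → k < a → 1ℤ ⊙ shift (suc k) (slice b (a ∸ suc k) ∘ B) ≋ shift a B′
  corrections k k<a = ≋-trans (λ n → ·ₛ-identityˡ _)
    (≋-trans (shift-cong (suc k) (B-slices (a ∸ suc k))) (shift-shift-∸ (suc k) a B′ k<a))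

private
  ∸-suc : ∀ {j a} → j < a → a ∸ j ≡ suc (a ∸ suc j)
  ∸-suc = ℕP.+-∸-assoc 1

  ∸-suc-suc : ∀ {j a} → j < a → suc a ∸ j ≡ suc (suc (a ∸ suc j))
  ∸-suc-suc {j} {a} j<a = trans (∸-suc (ℕP.<-trans j<a (ℕP.n<1+n a))) (cong suc (∸-suc j<a))

  shift-after-1 : ∀ {N} k (B : Seq N) → shift k (shift 1 B) ≋ shift (suc k) B
  shift-after-1 k B n = ≈-trans (shift-shift k 1 B n) (≈-reflexive (cong (λ j → shift j B n) (ℕP.+-comm k 1)))

module _ {N} {B : Seq (suc N)} {B′ : Seq N} (B-like : ElementaryLike B B′) where

  open ElementaryLike B-like
  open ≋-Reasoning

  p±⋆-x⁰ : slice false 0 ∘ (p± ⋆ B) ≋ p± ⋆ B′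
  p±⋆-x⁰ = begin
    slice false 0 ∘ (p± ⋆ B)
      ≈⟨ slice-powerSum-⋆ p±-powerSumLike false 0 B ⟩
    p± ⋆ (slice false 0 ∘ B) ⊕ ⨁ 0 (λ k → negPow (suc (suc k)) * 1ℤ ⊙ shift (suc k) (slice false (0 ∸ suc k) ∘ B))
      ≈⟨ ⊕-cong (⋆-cong ≋-refl slice-x⁰) (⨁-empty _) ⟩
    p± ⋆ B′ ⊕ 𝟘
      ≈⟨ ⊕-𝟘 (p± ⋆ B′) ⟩
    p± ⋆ B′ ∎

  p±⋆-x¹ : slice false 1 ∘ (p± ⋆ B) ≋ shift 1 (p± ⋆ B′) ⊕ (+ 1) ⊙ shift 1 B′
  p±⋆-x¹ = begin
    slice false 1 ∘ (p± ⋆ B)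
      ≈⟨ slice-powerSum-⋆ p±-powerSumLike false 1 B ⟩
    p± ⋆ (slice false 1 ∘ B) ⊕ ⨁ 1 F
      ≈⟨ ⊕-cong (≋-trans (⋆-cong ≋-refl slice-x¹) (⋆-shift 1 p± B′))
                (≋-trans (⨁-suc 0 F) (≋-trans (⊕-cong {A = F 0} ≋-refl (⨁-empty (F ∘ suc))) (⊕-𝟘 (F 0)))) ⟩
    shift 1 (p± ⋆ B′) ⊕ F 0
      ≈⟨ ⊕-cong {A = shift 1 (p± ⋆ B′)} ≋-refl (⊙-cong (+ 1) (shift-cong 1 slice-x⁰)) ⟩
    shift 1 (p± ⋆ B′) ⊕ (+ 1) ⊙ shift 1 B′ ∎
    where
    F : ℕ → Seq N
    F k = negPow (suc (suc k)) * 1ℤ ⊙ shift (suc k) (slice false (1 ∸ suc k) ∘ B)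

  p±⋆-x² : ∀ k → slice false (suc (suc k)) ∘ (p± ⋆ B) ≋ 𝟘
  p±⋆-x² k = begin
    slice false (suc (suc k)) ∘ (p± ⋆ B)
      ≈⟨ slice-powerSum-⋆ p±-powerSumLike false (suc (suc k)) B ⟩
    p± ⋆ (slice false (suc (suc k)) ∘ B) ⊕ ⨁ (suc (suc k)) F
      ≈⟨ ⊕-cong (≋-trans (⋆-cong ≋-refl (slice-x² k)) (⋆-𝟘 p±))
                (≋-trans (⨁-snoc (suc k) F) (⊕-cong (⨁-snoc k F) ≋-refl)) ⟩
    𝟘 ⊕ ((⨁ k F ⊕ F k) ⊕ F (suc k))
      ≈⟨ ⊕-cong {A = 𝟘} ≋-refl (⊕-cong (⊕-cong (⨁-zero k early) last-but-one) last) ⟩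
    𝟘 ⊕ ((𝟘 ⊕ c k ⊙ shift (suc (suc k)) B′) ⊕ c (suc k) ⊙ shift (suc (suc k)) B′)
      ≈⟨ (λ n m → cancel (negPow (suc (suc k))) (shift (suc (suc k)) B′ n m)) ⟩
    𝟘 ∎
    where
    c : ℕ → ℤ
    c j = negPow (suc (suc j)) * 1ℤ
    F : ℕ → Seq N
    F j = c j ⊙ shift (suc j) (slice false (suc (suc k) ∸ suc j) ∘ B)
    early : ∀ j → j < k → F j ≋ 𝟘
    early j j<k = ≋-trans (⊙-cong (c j) (shift-cong (suc j)
        (≋-trans (slice-index false B (∸-suc-suc j<k))
                 (slice-x² (k ∸ suc j)))))
      (λ n → ≈-trans (·ₛ-cong (c j) (shift-𝟘 (suc j) n)) (·ₛ-zeroʳ (c j)))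
    last-but-one : F k ≋ c k ⊙ shift (suc (suc k)) B′
    last-but-one = ⊙-cong (c k) (≋-trans (shift-cong (suc k) (≋-trans (slice-index false B (ℕP.m+n∸n≡m 1 k)) slice-x¹))
                                          (shift-after-1 (suc k) B′))
    last : F (suc k) ≋ c (suc k) ⊙ shift (suc (suc k)) B′
    last = ⊙-cong (c (suc k)) (shift-cong (suc (suc k)) (≋-trans (slice-index false B (ℕP.n∸n≡0 k)) slice-x⁰))
    cancel : ∀ x y → 0ℤ + ((0ℤ + x * 1ℤ * y) + (- x) * 1ℤ * y) ≡ 0ℤ
    cancel = solve-∀

-- Complete symmetric functions

private
  T⇒≡true : ∀ {b} → T b → b ≡ true
  T⇒≡true {true} _ = refl

  χ-∧ : ∀ b c → χ (b ∧ c) ≡ χ b * χ c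
  χ-∧ true  c = sym (ℤP.*-identityˡ (χ c))
  χ-∧ false c = refl

  χ-degree : ∀ d n B → χ (d <ᵇ suc n) * χ (B ≡ᵇ n ∸ d) ≡ χ (d ℕ.+ B ≡ᵇ n)
  χ-degree zero    n       B = ℤP.*-identityˡ _
  χ-degree (suc d) zero    B = refl
  χ-degree (suc d) (suc n) B = χ-degree d n B

  <ᵇ-⊓ : ∀ d k m → (d <ᵇ k ℕ.⊓ m) ≡ ((d <ᵇ k) ∧ (d <ᵇ m))
  <ᵇ-⊓ d       zero    m       = refl
  <ᵇ-⊓ zero    (suc k) zero    = refl
  <ᵇ-⊓ (suc d) (suc k) zero    with d <ᵇ k
  ... | true  = refl
  ... | false = refl
  <ᵇ-⊓ zero    (suc k) (suc m) = refl
  <ᵇ-⊓ (suc d) (suc k) (suc m) = <ᵇ-⊓ d k m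

∑-kronecker : ∀ n c (X : ℕ → ℤ) → ℤΣ.∑ n (λ k → χ (c ≡ᵇ k) * X k) ≡ χ (c <ᵇ n) * X c
∑-kronecker zero    c       X = sym (ℤP.*-zeroˡ (X c))
∑-kronecker (suc n) zero    X = trans (cong (_+_ (1ℤ * X 0)) (ℤΣ.∑-zero n (λ k _ → ℤP.*-zeroˡ (X (suc k)))))
                               (ℤP.+-identityʳ (1ℤ * X 0))
∑-kronecker (suc n) (suc c) X = trans (cong (_+ ℤΣ.∑ n (λ k → χ (suc c ≡ᵇ suc k) * X (suc k))) (ℤP.*-zeroˡ (X 0)))
                               (trans (ℤP.+-identityˡ _) (∑-kronecker n c (X ∘ suc)))

isNil : List ℕ → Bool
isNil []      = true
isNil (_ ∷ _) = false

headAtMost : ℕ → List ℕ → Bool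
headAtMost k []      = true
headAtMost k (d ∷ _) = d <ᵇ suc k

Descending : List ℕ → Set
Descending []      = ⊤
Descending (x ∷ l) = T (headAtMost x l) × Descending l

Positive : List ℕ → Set
Positive []          = ⊤
Positive (zero ∷ l)  = ⊥
Positive (suc x ∷ l) = Positive l

positiveParts : List ℕ → List ℕ
positiveParts = L.filter (λ b → 0 ℕ.<? b)

private
  ≤ᵇ-refl : ∀ a → T (a <ᵇ suc a)
  ≤ᵇ-refl zero    = tt
  ≤ᵇ-refl (suc a) = ≤ᵇ-refl a

  ≤ᵇ-total : ∀ a b → (a <ᵇ b) ≡ false → T (b <ᵇ suc a)
  ≤ᵇ-total a       zero    eq = tt
  ≤ᵇ-total zero    (suc b) ()
  ≤ᵇ-total (suc a) (suc b) eq = ≤ᵇ-total a b eq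

  <ᵇ⇒≤ᵇ : ∀ a b → (a <ᵇ b) ≡ true → T (a <ᵇ suc b)
  <ᵇ⇒≤ᵇ zero    b       eq = tt
  <ᵇ⇒≤ᵇ (suc a) (suc b) eq = <ᵇ⇒≤ᵇ a b eq

  ≤ᵇ-+ : ∀ a b → T (a <ᵇ suc (a ℕ.+ b))
  ≤ᵇ-+ zero    b = tt
  ≤ᵇ-+ (suc a) b = ≤ᵇ-+ a b

  headAtMost-insertD : ∀ a b l → T (a <ᵇ suc b) → T (headAtMost b l) → T (headAtMost b (insertD a l))
  headAtMost-insertD a b []      a≤b hb = a≤b
  headAtMost-insertD a b (c ∷ l) a≤b hb with a <ᵇ c
  ... | true  = hb
  ... | false = a≤b

insertD-descending : ∀ a l → Descending l → Descending (insertD a l)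
insertD-descending a []      _          = tt , tt
insertD-descending a (b ∷ l) (hb , dl) with a <ᵇ b in a<b
... | true  = headAtMost-insertD a b l (<ᵇ⇒≤ᵇ a b a<b) hb , insertD-descending a l dl
... | false = ≤ᵇ-total a b a<b , hb , dl

insertD-positive : ∀ a l → Positive l → Positive (insertD (suc a) l)
insertD-positive a []          _  = tt
insertD-positive a (zero ∷ l)  ()
insertD-positive a (suc b ∷ l) pl with suc a <ᵇ suc b
... | true  = insertD-positive a l pl
... | false = pl

insertD-sum : ∀ a l → sumℕ (insertD a l) ≡ a ℕ.+ sumℕ l
insertD-sum a []      = refl
insertD-sum a (b ∷ l) with a <ᵇ b
... | true  = trans (cong (b ℕ.+_) (insertD-sum a l)) (swap b a (sumℕ l))
  where
  swap : ∀ x y z → x ℕ.+ (y ℕ.+ z) ≡ y ℕ.+ (x ℕ.+ z)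
  swap x y z = trans (sym (ℕP.+-assoc x y z)) (trans (cong (ℕ._+ z) (ℕP.+-comm x y)) (ℕP.+-assoc y x z))
... | false = refl

sortD-descending : ∀ l → Descending (sortD l)
sortD-descending []      = tt
sortD-descending (x ∷ l) = insertD-descending x (sortD l) (sortD-descending l)

sortD-positive : ∀ l → Positive l → Positive (sortD l)
sortD-positive []          _  = tt
sortD-positive (zero ∷ l)  ()
sortD-positive (suc x ∷ l) pl = insertD-positive x (sortD l) (sortD-positive l pl)

sortD-sum : ∀ l → sumℕ (sortD l) ≡ sumℕ l
sortD-sum []      = refl
sortD-sum (x ∷ l) = trans (insertD-sum x (sortD l)) (cong (x ℕ.+_) (sortD-sum l))

headAtMost-sum : ∀ l → T (headAtMost (sumℕ l) l)
headAtMost-sum []      = tt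
headAtMost-sum (x ∷ l) = ≤ᵇ-+ x (sumℕ l)

partsB-count : ∀ f n k D → n ≤ f → Descending D → Positive D →
  ℤΣ.sumList (partsB f n k) (λ λs → χ (eqListℕ D (positiveParts λs))) ≡ χ (sumℕ D ≡ᵇ n) * χ (headAtMost k D)
partsB-count f       zero    k []          _         _  _  = refl
partsB-count f       zero    k (zero ∷ D)  _         _  ()
partsB-count f       zero    k (suc d ∷ D) _         _  _  = refl
partsB-count zero    (suc n) k D           ()        _  _
partsB-count (suc f) (suc n) k D           (s≤s n≤f) dD pD = begin
  ℤΣ.sumList (concatMap extend (upTo (k ℕ.⊓ suc n))) F
    ≡⟨ ℤΣ.sumList-concatMap extend (upTo (k ℕ.⊓ suc n)) F ⟩
  ℤΣ.sumList (upTo (k ℕ.⊓ suc n)) (λ j → ℤΣ.sumList (extend j) F)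
    ≡⟨ ℤΣ.sumList-applyUpTo id (k ℕ.⊓ suc n) (λ j → ℤΣ.sumList (extend j) F) ⟩
  ℤΣ.∑ (k ℕ.⊓ suc n) (λ j → ℤΣ.sumList (extend j) F)
    ≡⟨ ℤΣ.∑-cong (k ℕ.⊓ suc n) (λ j _ → ℤΣ.sumList-map (suc j ∷_) (partsB f (n ∸ j) (suc j)) F) ⟩
  ℤΣ.∑ (k ℕ.⊓ suc n) (λ j → ℤΣ.sumList (partsB f (n ∸ j) (suc j)) (λ λs → χ (eqListℕ D (suc j ∷ positiveParts λs))))
    ≡⟨ by-first-part D dD pD ⟩
  χ (sumℕ D ≡ᵇ suc n) * χ (headAtMost k D) ∎
  where
  open ≡-Reasoning
  F : List ℕ → ℤ
  F λs = χ (eqListℕ D (positiveParts λs))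
  extend : ℕ → List (List ℕ)
  extend j = L.map (suc j ∷_) (partsB f (suc n ∸ suc j) (suc j))
  count : ℕ → ℕ → List ℕ → ℤ
  count n′ k′ D′ = ℤΣ.sumList (partsB f n′ k′) (λ λs → χ (eqListℕ D′ (positiveParts λs)))
  by-first-part : ∀ D → Descending D → Positive D →
    ℤΣ.∑ (k ℕ.⊓ suc n) (λ j → ℤΣ.sumList (partsB f (n ∸ j) (suc j)) (λ λs → χ (eqListℕ D (suc j ∷ positiveParts λs))))
      ≡ χ (sumℕ D ≡ᵇ suc n) * χ (headAtMost k D)
  by-first-part []           _          _   = ℤΣ.∑-zero (k ℕ.⊓ suc n) (λ j _ → ℤΣ.sumList-ε (partsB f (n ∸ j) (suc j)) (λ _ → refl))
  by-first-part (zero ∷ D′)  _          ()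
  by-first-part (suc d ∷ D′) (hD′ , dD′) pD′ = begin
    ℤΣ.∑ (k ℕ.⊓ suc n) (λ j → ℤΣ.sumList (partsB f (n ∸ j) (suc j)) (λ λs → χ ((d ≡ᵇ j) ∧ eqListℕ D′ (positiveParts λs))))
      ≡⟨ ℤΣ.∑-cong (k ℕ.⊓ suc n) (λ j _ →
           trans (ℤΣ.sumList-cong (partsB f (n ∸ j) (suc j)) (λ λs → χ-∧ (d ≡ᵇ j) (eqListℕ D′ (positiveParts λs))))
                 (sumList-*ℤ (χ (d ≡ᵇ j)) (partsB f (n ∸ j) (suc j)) (λ λs → χ (eqListℕ D′ (positiveParts λs))))) ⟩
    ℤΣ.∑ (k ℕ.⊓ suc n) (λ j → χ (d ≡ᵇ j) * count (n ∸ j) (suc j) D′)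
      ≡⟨ ∑-kronecker (k ℕ.⊓ suc n) d (λ j → count (n ∸ j) (suc j) D′) ⟩
    χ (d <ᵇ k ℕ.⊓ suc n) * count (n ∸ d) (suc d) D′
      ≡⟨ cong₂ _*_ (trans (cong χ (<ᵇ-⊓ d k (suc n))) (χ-∧ (d <ᵇ k) (d <ᵇ suc n)))
                   (trans (partsB-count f (n ∸ d) (suc d) D′ (ℕP.≤-trans (ℕP.m∸n≤m n d) n≤f) dD′ pD′)
                          (cong (λ b → χ (sumℕ D′ ≡ᵇ n ∸ d) * χ b) (T⇒≡true hD′))) ⟩
    χ (d <ᵇ k) * χ (d <ᵇ suc n) * (χ (sumℕ D′ ≡ᵇ n ∸ d) * 1ℤ)
      ≡⟨ regroup (χ (d <ᵇ k)) (χ (d <ᵇ suc n)) (χ (sumℕ D′ ≡ᵇ n ∸ d)) ⟩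
    χ (d <ᵇ suc n) * χ (sumℕ D′ ≡ᵇ n ∸ d) * χ (d <ᵇ k)
      ≡⟨ cong (_* χ (d <ᵇ k)) (χ-degree d n (sumℕ D′)) ⟩
    χ (d ℕ.+ sumℕ D′ ≡ᵇ n) * χ (d <ᵇ k) ∎
    where
    regroup : ∀ x y z → x * y * (z * 1ℤ) ≡ y * z * x
    regroup = solve-∀

Par-count : ∀ n D → Descending D → Positive D →
  ℤΣ.sumList (Par n) (λ λs → χ (eqListℕ D (positiveParts λs))) ≡ χ (sumℕ D ≡ᵇ n)
Par-count n D dD pD with sumℕ D ≡ᵇ n in D⊢n
... | false = trans (partsB-count n n n D ℕP.≤-refl dD pD) (trans (cong (λ b → χ b * χ (headAtMost n D)) D⊢n) (ℤP.*-zeroˡ (χ (headAtMost n D))))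
... | true  = trans (partsB-count n n n D ℕP.≤-refl dD pD)
    (trans (cong₂ (λ b k → χ b * χ (headAtMost k D)) D⊢n (sym (ℕP.≡ᵇ⇒≡ (sumℕ D) n (subst T (sym D⊢n) tt))))
           (cong (λ b → 1ℤ * χ b) (T⇒≡true (headAtMost-sum D))))

degree : ∀ {N} → Vec ℕ N → ℕ
degree []      = 0
degree (a ∷ α) = a ℕ.+ degree α

degree-split : ∀ {N} (S : Vec Bool N) α → degree α ≡ sumℕ (fermExps S α) ℕ.+ sumℕ (bosExps S α)
degree-split []          []          = refl
degree-split (true ∷ S)  (a ∷ α)     = trans (cong (a ℕ.+_) (degree-split S α)) (sym (ℕP.+-assoc a _ _))
degree-split (false ∷ S) (zero ∷ α)  = degree-split S α
degree-split (false ∷ S) (suc a ∷ α) = trans (cong (suc a ℕ.+_) (degree-split S α)) (swap (suc a) _ _)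
  where
  swap : ∀ x y z → x ℕ.+ (y ℕ.+ z) ≡ y ℕ.+ (x ℕ.+ z)
  swap x y z = trans (sym (ℕP.+-assoc x y z)) (trans (cong (ℕ._+ z) (ℕP.+-comm x y)) (ℕP.+-assoc y x z))

bosExps-positive : ∀ {N} (S : Vec Bool N) α → Positive (bosExps S α)
bosExps-positive []          []          = tt
bosExps-positive (true ∷ S)  (a ∷ α)     = bosExps-positive S α
bosExps-positive (false ∷ S) (zero ∷ α)  = bosExps-positive S α
bosExps-positive (false ∷ S) (suc a ∷ α) = bosExps-positive S α

mΛ-on : List ℕ → List ℕ → List ℕ → List ℕ → ℤ
mΛ-on F B fe be = if eqListℕ (sortD fe) F ∧ eqListℕ (sortD be) (positiveParts B) then negPow (ascPairs fe) else 0ℤ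

private
  insertD-length : ∀ a l → L.length (insertD a l) ≡ suc (L.length l)
  insertD-length a []      = refl
  insertD-length a (b ∷ l) with a <ᵇ b
  ... | true  = cong suc (insertD-length a l)
  ... | false = refl

  sortD-length : ∀ l → L.length (sortD l) ≡ L.length l
  sortD-length []      = refl
  sortD-length (x ∷ l) = trans (insertD-length x (sortD l)) (cong suc (sortD-length l))

  eqListℕ-length : ∀ xs ys → eqListℕ xs ys ≡ true → L.length xs ≡ L.length ys
  eqListℕ-length []       []       _  = refl
  eqListℕ-length (x ∷ xs) (y ∷ ys) eq with x ≡ᵇ y
  ... | true  = cong suc (eqListℕ-length xs ys eq)
  eqListℕ-length []       (_ ∷ _)  ()
  eqListℕ-length (_ ∷ _)  []       ()

mΛ-on-length : ∀ F B fe be → L.length fe ≢ L.length F → mΛ-on F B fe be ≡ 0ℤ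
mΛ-on-length F B fe be ≢F with eqListℕ (sortD fe) F in fe≈F
... | false = refl
... | true  = ⊥-elim (≢F (trans (sym (sortD-length fe)) (eqListℕ-length (sortD fe) F fe≈F)))

h-coefficient : ∀ n fe be → Positive be →
  ℤΣ.sumList (Par n) (λ λs → mΛ-on [] λs fe be) ≡ χ (isNil fe) * χ (sumℕ fe ℕ.+ sumℕ be ≡ᵇ n)
h-coefficient n [] be be-pos = begin
  ℤΣ.sumList (Par n) (λ λs → χ (eqListℕ (sortD be) (positiveParts λs)))
    ≡⟨ Par-count n (sortD be) (sortD-descending be) (sortD-positive be be-pos) ⟩
  χ (sumℕ (sortD be) ≡ᵇ n)
    ≡⟨ cong (λ s → χ (s ≡ᵇ n)) (sortD-sum be) ⟩
  χ (sumℕ be ≡ᵇ n)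
    ≡⟨ sym (ℤP.*-identityˡ _) ⟩
  1ℤ * χ (sumℕ be ≡ᵇ n) ∎
  where open ≡-Reasoning
h-coefficient n (x ∷ xs) be _ = ℤΣ.sumList-ε (Par n) (λ λs → mΛ-on-length [] λs (x ∷ xs) be (λ ()))

h~-weight : List ℕ → ℤ
h~-weight (c ∷ []) = + suc c
h~-weight _        = 0ℤ

h~-coefficient : ∀ n fe be → Positive be →
  ℤΣ.∑ (suc n) (λ a → ℤΣ.sumList (Par (n ∸ a)) (λ λs → + suc a * mΛ-on [ a ] λs fe be))
    ≡ h~-weight fe * χ (sumℕ fe ℕ.+ sumℕ be ≡ᵇ n)
h~-coefficient n [] be _ =
  ℤΣ.∑-zero (suc n) (λ a _ → ℤΣ.sumList-ε (Par (n ∸ a)) (λ λs →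
    trans (cong (+ suc a *_) (mΛ-on-length [ a ] λs [] be (λ ()))) (ℤP.*-zeroʳ (+ suc a))))
h~-coefficient n (x ∷ y ∷ xs) be _ =
  ℤΣ.∑-zero (suc n) (λ a _ → ℤΣ.sumList-ε (Par (n ∸ a)) (λ λs →
    trans (cong (+ suc a *_) (mΛ-on-length [ a ] λs (x ∷ y ∷ xs) be (λ ()))) (ℤP.*-zeroʳ (+ suc a))))
h~-coefficient n (c ∷ []) be be-pos = begin
  ℤΣ.∑ (suc n) (λ a → ℤΣ.sumList (Par (n ∸ a)) (λ λs → + suc a * mΛ-on [ a ] λs [ c ] be))
    ≡⟨ ℤΣ.∑-cong (suc n) (λ a _ → trans (ℤΣ.sumList-cong (Par (n ∸ a)) (λ λs → split a λs))
                                        (sumList-*ℤ (χ (c ≡ᵇ a)) (Par (n ∸ a)) (λ λs → + suc a * E λs))) ⟩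
  ℤΣ.∑ (suc n) (λ a → χ (c ≡ᵇ a) * ℤΣ.sumList (Par (n ∸ a)) (λ λs → + suc a * E λs))
    ≡⟨ ∑-kronecker (suc n) c (λ a → ℤΣ.sumList (Par (n ∸ a)) (λ λs → + suc a * E λs)) ⟩
  χ (c <ᵇ suc n) * ℤΣ.sumList (Par (n ∸ c)) (λ λs → + suc c * E λs)
    ≡⟨ cong (χ (c <ᵇ suc n) *_) (trans (sumList-*ℤ (+ suc c) (Par (n ∸ c)) E)
         (cong (+ suc c *_) (trans (Par-count (n ∸ c) (sortD be) (sortD-descending be) (sortD-positive be be-pos))
                                   (cong (λ s → χ (s ≡ᵇ n ∸ c)) (sortD-sum be))))) ⟩
  χ (c <ᵇ suc n) * (+ suc c * χ (sumℕ be ≡ᵇ n ∸ c))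
    ≡⟨ trans (swap (χ (c <ᵇ suc n)) (+ suc c) _) (cong (+ suc c *_) (χ-degree c n (sumℕ be))) ⟩
  + suc c * χ (c ℕ.+ sumℕ be ≡ᵇ n)
    ≡⟨ cong (λ d → + suc c * χ (d ℕ.+ sumℕ be ≡ᵇ n)) (sym (ℕP.+-identityʳ c)) ⟩
  + suc c * χ (c ℕ.+ 0 ℕ.+ sumℕ be ≡ᵇ n) ∎
  where
  open ≡-Reasoning
  E : List ℕ → ℤ
  E λs = χ (eqListℕ (sortD be) (positiveParts λs))
  split : ∀ a λs → + suc a * mΛ-on [ a ] λs [ c ] be ≡ χ (c ≡ᵇ a) * (+ suc a * E λs)
  split a λs with c ≡ᵇ a
  ... | true  = sym (ℤP.*-identityˡ (+ suc a * E λs))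
  ... | false = ℤP.*-zeroʳ (+ suc a)
  swap : ∀ x y z → x * (y * z) ≡ y * (x * z)
  swap = solve-∀

h-value : ∀ {N} n (S : Vec Bool N) α → h n (mono S α) ≡ χ (isNil (fermExps S α)) * χ (degree α ≡ᵇ n)
h-value n S α = begin
  h n (mono S α)
    ≡⟨ ΣL-at (Par n) (λ λs → mΛ (spar [] λs)) (mono S α) ⟩
  ℤΣ.sumList (Par n) (λ λs → mΛ-on [] λs (fermExps S α) (bosExps S α))
    ≡⟨ h-coefficient n (fermExps S α) (bosExps S α) (bosExps-positive S α) ⟩
  χ (isNil (fermExps S α)) * χ (sumℕ (fermExps S α) ℕ.+ sumℕ (bosExps S α) ≡ᵇ n)
    ≡⟨ cong (λ d → χ (isNil (fermExps S α)) * χ (d ≡ᵇ n)) (sym (degree-split S α)) ⟩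
  χ (isNil (fermExps S α)) * χ (degree α ≡ᵇ n) ∎
  where open ≡-Reasoning

h~-value : ∀ {N} n (S : Vec Bool N) α → h~ n (mono S α) ≡ h~-weight (fermExps S α) * χ (degree α ≡ᵇ n)
h~-value n S α = begin
  h~ n (mono S α)
    ≡⟨ ΣL-at (SPar1 n) (λ Λ → (+ suc (Λ₁ Λ)) ·ₛ mΛ Λ) (mono S α) ⟩
  ℤΣ.sumList (SPar1 n) G
    ≡⟨ ℤΣ.sumList-concatMap (λ a → L.map (λ λs → spar [ a ] λs) (Par (n ∸ a))) (upTo (suc n)) G ⟩
  ℤΣ.sumList (upTo (suc n)) (λ a → ℤΣ.sumList (L.map (λ λs → spar [ a ] λs) (Par (n ∸ a))) G)
    ≡⟨ ℤΣ.sumList-applyUpTo id (suc n) (λ a → ℤΣ.sumList (L.map (λ λs → spar [ a ] λs) (Par (n ∸ a))) G) ⟩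
  ℤΣ.∑ (suc n) (λ a → ℤΣ.sumList (L.map (λ λs → spar [ a ] λs) (Par (n ∸ a))) G)
    ≡⟨ ℤΣ.∑-cong (suc n) (λ a _ → ℤΣ.sumList-map (λ λs → spar [ a ] λs) (Par (n ∸ a)) G) ⟩
  ℤΣ.∑ (suc n) (λ a → ℤΣ.sumList (Par (n ∸ a)) (λ λs → + suc a * mΛ-on [ a ] λs (fermExps S α) (bosExps S α)))
    ≡⟨ h~-coefficient n (fermExps S α) (bosExps S α) (bosExps-positive S α) ⟩
  h~-weight (fermExps S α) * χ (sumℕ (fermExps S α) ℕ.+ sumℕ (bosExps S α) ≡ᵇ n)
    ≡⟨ cong (λ d → h~-weight (fermExps S α) * χ (d ≡ᵇ n)) (sym (degree-split S α)) ⟩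
  h~-weight (fermExps S α) * χ (degree α ≡ᵇ n) ∎
  where
  open ≡-Reasoning
  G : SPar → ℤ
  G Λ = + suc (Λ₁ Λ) * mΛ Λ (mono S α)

slice-false-homogeneous : ∀ {N} (A : Seq (suc N)) (A′ : Seq N) (w : Mono N → ℤ) →
  (∀ n S α → A′ n (mono S α) ≡ w (mono S α) * χ (degree α ≡ᵇ n)) →
  (∀ a n S α → A n (mono (false ∷ S) (a ∷ α)) ≡ w (mono S α) * χ (a ℕ.+ degree α ≡ᵇ n)) →
  ∀ a → slice false a ∘ A ≋ shift a A′
slice-false-homogeneous A A′ w A′-value A-value = go
  where
  go : ∀ a n → slice false a (A n) ≈ shift a A′ n
  go zero    n       (mono S α) = trans (A-value 0 n S α) (sym (A′-value n S α))
  go (suc a) zero    (mono S α) = trans (A-value (suc a) 0 S α) (ℤP.*-zeroʳ (w (mono S α)))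
  go (suc a) (suc n) (mono S α) = trans (A-value (suc a) (suc n) S α) (trans (sym (A-value a n S α)) (go a n (mono S α)))

slice-h-false : ∀ {N} a → slice false a ∘ h {suc N} ≋ shift a h
slice-h-false = slice-false-homogeneous h h (λ { (mono S α) → χ (isNil (fermExps S α)) })
  (λ n S α → h-value n S α) (λ a n S α → h-value n (false ∷ S) (a ∷ α))

slice-h-true : ∀ {N} a → slice true a ∘ h {suc N} ≋ 𝟘
slice-h-true a n (mono S α) = trans (h-value n (true ∷ S) (a ∷ α)) (ℤP.*-zeroˡ (χ (a ℕ.+ degree α ≡ᵇ n)))

slice-h~-false : ∀ {N} a → slice false a ∘ h~ {suc N} ≋ shift a h~
slice-h~-false = slice-false-homogeneous h~ h~ (λ { (mono S α) → h~-weight (fermExps S α) })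
  (λ n S α → h~-value n S α) (λ a n S α → h~-value n (false ∷ S) (a ∷ α))

slice-h~-true : ∀ {N} a → slice true a ∘ h~ {suc N} ≋ (+ suc a) ⊙ shift a h
slice-h~-true a n (mono S α) = begin
  h~ n (mono (true ∷ S) (a ∷ α))
    ≡⟨ h~-value n (true ∷ S) (a ∷ α) ⟩
  h~-weight (a ∷ fermExps S α) * χ (a ℕ.+ degree α ≡ᵇ n)
    ≡⟨ cong (_* χ (a ℕ.+ degree α ≡ᵇ n)) (h~-weight-cons (fermExps S α)) ⟩
  + suc a * χ (isNil (fermExps S α)) * χ (a ℕ.+ degree α ≡ᵇ n)
    ≡⟨ ℤP.*-assoc (+ suc a) (χ (isNil (fermExps S α))) (χ (a ℕ.+ degree α ≡ᵇ n)) ⟩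
  + suc a * (χ (isNil (fermExps S α)) * χ (a ℕ.+ degree α ≡ᵇ n))
    ≡⟨ cong (+ suc a *_) (sym (h-value n (false ∷ S) (a ∷ α))) ⟩
  + suc a * h n (mono (false ∷ S) (a ∷ α))
    ≡⟨ cong (+ suc a *_) (slice-h-false a n (mono S α)) ⟩
  + suc a * shift a h n (mono S α) ∎
  where
  open ≡-Reasoning
  h~-weight-cons : ∀ fe → h~-weight (a ∷ fe) ≡ + suc a * χ (isNil fe)
  h~-weight-cons []      = sym (ℤP.*-identityʳ (+ suc a))
  h~-weight-cons (_ ∷ _) = sym (ℤP.*-zeroʳ (+ suc a))

-- Elementary functions

x^ : ∀ {N} → Vec Bool N → SPoly N
x^ {N} J = mon (mono (V.replicate N false) (indicator J))

θx^ : ∀ {N} → Fin N → Vec Bool N → SPoly N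
θx^ i J = if V.lookup J i then 0ₛ else mon (mono (single i) (indicator J))

bit : Bool → ℕ
bit c = if c then 1 else 0

subsetSum : ∀ {N} → ℕ → (Vec Bool N → SPoly N) → SPoly N
subsetSum {N} n G = ΣL (allSubsets N) (λ J → χ (countT J ≡ᵇ n) ·ₛ G J)

ΣL-filter-count : ∀ {N M} n (xs : List (Vec Bool M)) (F : Vec Bool M → SPoly N) →
  ΣL (L.filter (λ J → countT J ℕ.≟ n) xs) F ≈ ΣL xs (λ J → χ (countT J ≡ᵇ n) ·ₛ F J)
ΣL-filter-count n []       F = ≈-refl
ΣL-filter-count n (J ∷ xs) F with countT J ≡ᵇ n
... | true  = +ₛ-cong (≈-sym (·ₛ-identityˡ (F J))) (ΣL-filter-count n xs F)
... | false = λ m → trans (ΣL-filter-count n xs F m)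
                          (sym (trans (cong (_+ rest m) (ℤP.*-zeroˡ (F J m))) (ℤP.+-identityˡ (rest m))))
  where
  rest : SPoly _
  rest = ΣL xs (λ J → χ (countT J ≡ᵇ n) ·ₛ F J)

e-as-subsetSum : ∀ {N} n → e {N} n ≈ subsetSum n x^
e-as-subsetSum {N} n = ΣL-filter-count n (allSubsets N) x^

e~-as-subsetSum : ∀ {N} n → e~ {N} n ≈ ΣL (allFin N) (λ i → subsetSum n (θx^ i))
e~-as-subsetSum {N} n = PolySums.sumList-cong (allFin N) (λ i → ΣL-filter-count n (allSubsets N) (θx^ i))

shift₁-subsetSum : ∀ {N} (G : Vec Bool N → SPoly N) n →
  shift 1 (λ k → subsetSum k G) n ≈ ΣL (allSubsets N) (λ J → χ (suc (countT J) ≡ᵇ n) ·ₛ G J)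
shift₁-subsetSum {N} G zero    = ≈-sym (PolySums.sumList-ε (allSubsets N) (λ J m → ℤP.*-zeroˡ (G J m)))
shift₁-subsetSum {N} G (suc n) = ≈-refl

shift₁-ΣL : ∀ {N} {A : Set} (xs : List A) (F : ℕ → A → SPoly N) n →
  shift 1 (λ k → ΣL xs (F k)) n ≈ ΣL xs (λ x → shift 1 (λ k → F k x) n)
shift₁-ΣL xs F zero    = ≈-sym (PolySums.sumList-ε xs (λ _ → ≈-refl))
shift₁-ΣL xs F (suc n) = ≈-refl

slice-subsetSum : ∀ {N} b a n (G⁺ : Vec Bool (suc N) → SPoly (suc N)) (G : Vec Bool N → SPoly N) u u′ →
  (∀ v → slice b a (G⁺ (false ∷ v)) ≈ u ·ₛ G v) → (∀ v → slice b a (G⁺ (true ∷ v)) ≈ u′ ·ₛ G v) →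
  slice b a (subsetSum n G⁺) ≈ u ·ₛ subsetSum n G +ₛ u′ ·ₛ shift 1 (λ k → subsetSum k G) n
slice-subsetSum {N} b a n G⁺ G u u′ G⁺₀ G⁺₁ = begin
  slice b a (ΣL (allSubsets (suc N)) F)
    ≈⟨ slice-cong b a (PolySums.sumList-concatMap (λ v → (false ∷ v) ∷ (true ∷ v) ∷ []) (allSubsets N) F) ⟩
  slice b a (ΣL (allSubsets N) (λ v → F (false ∷ v) +ₛ (F (true ∷ v) +ₛ 0ₛ)))
    ≈⟨ slice-ΣL b a (allSubsets N) (λ v → F (false ∷ v) +ₛ (F (true ∷ v) +ₛ 0ₛ)) ⟩
  ΣL (allSubsets N) (λ v → slice b a (F (false ∷ v) +ₛ (F (true ∷ v) +ₛ 0ₛ)))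
    ≈⟨ PolySums.sumList-cong (allSubsets N) (λ v m → trans
         (cong₂ (λ x y → χ (countT v ≡ᵇ n) * x + (χ (suc (countT v) ≡ᵇ n) * y + 0ℤ)) (G⁺₀ v m) (G⁺₁ v m))
         (regroup (χ (countT v ≡ᵇ n)) (χ (suc (countT v) ≡ᵇ n)) u u′ (G v m))) ⟩
  ΣL (allSubsets N) (λ v → u ·ₛ (χ (countT v ≡ᵇ n) ·ₛ G v) +ₛ u′ ·ₛ (χ (suc (countT v) ≡ᵇ n) ·ₛ G v))
    ≈⟨ ≈-trans (ΣL-+ₛ (allSubsets N) (λ v → u ·ₛ (χ (countT v ≡ᵇ n) ·ₛ G v)) (λ v → u′ ·ₛ (χ (suc (countT v) ≡ᵇ n) ·ₛ G v)))
               (+ₛ-cong (ΣL-·ₛ u (allSubsets N) (λ v → χ (countT v ≡ᵇ n) ·ₛ G v))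
                        (ΣL-·ₛ u′ (allSubsets N) (λ v → χ (suc (countT v) ≡ᵇ n) ·ₛ G v))) ⟩
  u ·ₛ subsetSum n G +ₛ u′ ·ₛ ΣL (allSubsets N) (λ v → χ (suc (countT v) ≡ᵇ n) ·ₛ G v)
    ≈⟨ +ₛ-cong {f = u ·ₛ subsetSum n G} ≈-refl (·ₛ-cong u′ (≈-sym (shift₁-subsetSum G n))) ⟩
  u ·ₛ subsetSum n G +ₛ u′ ·ₛ shift 1 (λ k → subsetSum k G) n ∎
  where
  open ≈-Reasoning
  F : Vec Bool (suc N) → SPoly (suc N)
  F J = χ (countT J ≡ᵇ n) ·ₛ G⁺ J
  regroup : ∀ x y u u′ g → x * (u * g) + (y * (u′ * g) + 0ℤ) ≡ u * (x * g) + u′ * (y * g)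
  regroup = solve-∀

private
  x^-slice : ∀ {N} b a c (v : Vec Bool N) → slice b a (x^ (c ∷ v)) ≈ χ (not b ∧ (bit c ≡ᵇ a)) ·ₛ x^ v
  x^-slice {N} b a c v = slice-mon b a false (bit c) (V.replicate N false) (indicator v)

  θx^-zero-slice : ∀ {N} b a (v : Vec Bool N) → slice b a (θx^ zero (false ∷ v)) ≈ χ (b ∧ (0 ≡ᵇ a)) ·ₛ x^ v
  θx^-zero-slice {N} b a v =
    ≈-trans (≈-reflexive (cong (λ S → slice b a (mon (mono S (0 ∷ indicator v)))) single-zero))
            (slice-mon b a true 0 (V.replicate N false) (indicator v))

  θx^-suc-slice : ∀ {N} b a (i : Fin N) c v → slice b a (θx^ (suc i) (c ∷ v)) ≈ χ (not b ∧ (bit c ≡ᵇ a)) ·ₛ θx^ i v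
  θx^-suc-slice b a i c v with V.lookup v i
  ... | true  = ≈-sym (·ₛ-zeroʳ (χ (not b ∧ (bit c ≡ᵇ a))))
  ... | false = ≈-trans (≈-reflexive (cong (λ S → slice b a (mon (mono S (bit c ∷ indicator v)))) (single-suc i)))
                        (slice-mon b a false (bit c) (single i) (indicator v))

slice-e : ∀ {N} b a n →
  slice b a (e {suc N} n) ≈ χ (not b ∧ (0 ≡ᵇ a)) ·ₛ e n +ₛ χ (not b ∧ (1 ≡ᵇ a)) ·ₛ shift 1 e n
slice-e b a n = begin
  slice b a (e n)
    ≈⟨ slice-cong b a (e-as-subsetSum n) ⟩
  slice b a (subsetSum n x^)
    ≈⟨ slice-subsetSum b a n x^ x^ (χ (not b ∧ (0 ≡ᵇ a))) (χ (not b ∧ (1 ≡ᵇ a))) (x^-slice b a false) (x^-slice b a true) ⟩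
  χ (not b ∧ (0 ≡ᵇ a)) ·ₛ subsetSum n x^ +ₛ χ (not b ∧ (1 ≡ᵇ a)) ·ₛ shift 1 (λ k → subsetSum k x^) n
    ≈⟨ +ₛ-cong (·ₛ-cong (χ (not b ∧ (0 ≡ᵇ a))) (≈-sym (e-as-subsetSum n)))
               (·ₛ-cong (χ (not b ∧ (1 ≡ᵇ a))) (shift-cong 1 (λ k → ≈-sym (e-as-subsetSum k)) n)) ⟩
  χ (not b ∧ (0 ≡ᵇ a)) ·ₛ e n +ₛ χ (not b ∧ (1 ≡ᵇ a)) ·ₛ shift 1 e n ∎
  where open ≈-Reasoning

slice-e~ : ∀ {N} b a n →
  slice b a (e~ {suc N} n)
    ≈ χ (b ∧ (0 ≡ᵇ a)) ·ₛ e n +ₛ (χ (not b ∧ (0 ≡ᵇ a)) ·ₛ e~ n +ₛ χ (not b ∧ (1 ≡ᵇ a)) ·ₛ shift 1 e~ n)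
slice-e~ {N} b a n = begin
  slice b a (e~ n)
    ≈⟨ slice-cong b a (≈-trans (e~-as-subsetSum n) (ΣL-allFin-suc (λ i → subsetSum n (θx^ i)))) ⟩
  slice b a (subsetSum n (θx^ zero)) +ₛ slice b a (ΣL (allFin N) (λ i → subsetSum n (θx^ (suc i))))
    ≈⟨ +ₛ-cong first (≈-trans (slice-ΣL b a (allFin N) (λ i → subsetSum n (θx^ (suc i)))) rest) ⟩
  χ (b ∧ (0 ≡ᵇ a)) ·ₛ e n +ₛ (u ·ₛ e~ n +ₛ u′ ·ₛ shift 1 e~ n) ∎
  where
  open ≈-Reasoning
  u u′ : ℤ
  u  = χ (not b ∧ (0 ≡ᵇ a))
  u′ = χ (not b ∧ (1 ≡ᵇ a))
  first : slice b a (subsetSum n (θx^ zero)) ≈ χ (b ∧ (0 ≡ᵇ a)) ·ₛ e n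
  first = ≈-trans (slice-subsetSum b a n (θx^ zero) x^ (χ (b ∧ (0 ≡ᵇ a))) 0ℤ (θx^-zero-slice b a) (λ v m → sym (ℤP.*-zeroˡ (x^ v m))))
                  (λ m → trans (cong (_+_ (χ (b ∧ (0 ≡ᵇ a)) * subsetSum n x^ m)) (ℤP.*-zeroˡ (shift 1 (λ k → subsetSum k x^) n m)))
                               (trans (ℤP.+-identityʳ _) (cong (χ (b ∧ (0 ≡ᵇ a)) *_) (sym (e-as-subsetSum n m)))))
  rest : ΣL (allFin N) (λ i → slice b a (subsetSum n (θx^ (suc i)))) ≈ u ·ₛ e~ n +ₛ u′ ·ₛ shift 1 e~ n
  rest = begin
    ΣL (allFin N) (λ i → slice b a (subsetSum n (θx^ (suc i))))
      ≈⟨ PolySums.sumList-cong (allFin N) (λ i →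
           slice-subsetSum b a n (θx^ (suc i)) (θx^ i) u u′ (θx^-suc-slice b a i false) (θx^-suc-slice b a i true)) ⟩
    ΣL (allFin N) (λ i → u ·ₛ subsetSum n (θx^ i) +ₛ u′ ·ₛ shift 1 (λ k → subsetSum k (θx^ i)) n)
      ≈⟨ ≈-trans (ΣL-+ₛ (allFin N) (λ i → u ·ₛ subsetSum n (θx^ i)) (λ i → u′ ·ₛ shift 1 (λ k → subsetSum k (θx^ i)) n))
                 (+ₛ-cong (ΣL-·ₛ u (allFin N) (λ i → subsetSum n (θx^ i)))
                          (ΣL-·ₛ u′ (allFin N) (λ i → shift 1 (λ k → subsetSum k (θx^ i)) n))) ⟩
    u ·ₛ ΣL (allFin N) (λ i → subsetSum n (θx^ i)) +ₛ u′ ·ₛ ΣL (allFin N) (λ i → shift 1 (λ k → subsetSum k (θx^ i)) n)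
      ≈⟨ +ₛ-cong (·ₛ-cong u (≈-sym (e~-as-subsetSum n)))
                 (·ₛ-cong u′ (≈-trans (≈-sym (shift₁-ΣL (allFin N) (λ k i → subsetSum k (θx^ i)) n))
                                      (shift-cong 1 (λ k → ≈-sym (e~-as-subsetSum k)) n))) ⟩
    u ·ₛ e~ n +ₛ u′ ·ₛ shift 1 e~ n ∎

e-elementaryLike : ∀ {N} → ElementaryLike (e {suc N}) e
e-elementaryLike = record
  { slice-x⁰ = λ n → ≈-trans (slice-e false 0 n) (λ m → keep-first (e n m) (shift 1 e n m))
  ; slice-x¹ = λ n → ≈-trans (slice-e false 1 n) (λ m → keep-second (e n m) (shift 1 e n m))
  ; slice-x² = λ k n → ≈-trans (slice-e false (suc (suc k)) n) (λ m → keep-none (e n m) (shift 1 e n m))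
  }

slice-e-θ : ∀ {N} a → slice true a ∘ e {suc N} ≋ 𝟘
slice-e-θ a n = ≈-trans (slice-e true a n) (λ m → keep-none (e n m) (shift 1 e n m))

e~-elementaryLike : ∀ {N} → ElementaryLike (e~ {suc N}) e~
e~-elementaryLike = record
  { slice-x⁰ = λ n → ≈-trans (slice-e~ false 0 n) (λ m → drop-e (e n m) (keep-first (e~ n m) (shift 1 e~ n m)))
  ; slice-x¹ = λ n → ≈-trans (slice-e~ false 1 n) (λ m → drop-e (e n m) (keep-second (e~ n m) (shift 1 e~ n m)))
  ; slice-x² = λ k n → ≈-trans (slice-e~ false (suc (suc k)) n) (λ m → drop-e (e n m) (keep-none (e~ n m) (shift 1 e~ n m)))
  }
  where
  drop-e : ∀ x {y z} → y ≡ z → 0ℤ * x + y ≡ z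
  drop-e x {y} y≡z = trans (cong (_+ y) (ℤP.*-zeroˡ x)) (trans (ℤP.+-identityˡ y) y≡z)

slice-e~-θ⁰ : ∀ {N} → slice true 0 ∘ e~ {suc N} ≋ e
slice-e~-θ⁰ n = ≈-trans (slice-e~ true 0 n) (λ m → trans (cong (_+_ (1ℤ * e n m)) (keep-none (e~ n m) (shift 1 e~ n m)))
                                                        (trans (ℤP.+-identityʳ _) (ℤP.*-identityˡ _)))

slice-e~-θˢᵘᶜ : ∀ {N} a → slice true (suc a) ∘ e~ {suc N} ≋ 𝟘
slice-e~-θˢᵘᶜ a n = ≈-trans (slice-e~ true (suc a) n)
  (λ m → trans (cong (_+_ (0ℤ * e n m)) (keep-none (e~ n m) (shift 1 e~ n m))) (trans (ℤP.+-identityʳ _) (ℤP.*-zeroˡ (e n m))))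

-- Newton's identities

p-no-variables : p {0} ≋ 𝟘
p-no-variables zero    = ≈-refl
p-no-variables (suc r) = ≈-refl

p~-no-variables : p~ {0} ≋ 𝟘
p~-no-variables r = ≈-refl

h-no-variables : h {0} ≋ 𝟙
h-no-variables zero    (mono [] []) = h-value 0 [] []
h-no-variables (suc n) (mono [] []) = h-value (suc n) [] []

e-no-variables : e {0} ≋ 𝟙
e-no-variables zero    (mono [] []) = e-as-subsetSum 0 (mono [] [])
e-no-variables (suc n) (mono [] []) = e-as-subsetSum (suc n) (mono [] [])

h~-no-variables : h~ {0} ≋ 𝟘
h~-no-variables n (mono [] []) = h~-value n [] []

e~-no-variables : e~ {0} ≋ 𝟘
e~-no-variables n = ≈-refl

p±-no-variables : p± {0} ≋ 𝟘
p±-no-variables r = ≈-trans (·ₛ-cong (negPow (suc r)) (p-no-variables r)) (·ₛ-zeroʳ (negPow (suc r)))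

p~±-no-variables : p~± {0} ≋ 𝟘
p~±-no-variables r = ≈-trans (·ₛ-cong (negPow r * + suc r) (p~-no-variables r)) (·ₛ-zeroʳ (negPow r * + suc r))

newton-h : ∀ N → ν (h {N}) ≋ p ⋆ h
newton-h zero = begin
  ν h     ≈⟨ ν-cong h-no-variables ⟩
  ν 𝟙     ≈⟨ ν-𝟙 ⟩
  𝟘       ≈⟨ ≋-sym (𝟘-⋆ h) ⟩
  𝟘 ⋆ h   ≈⟨ ⋆-cong (≋-sym p-no-variables) ≋-refl ⟩
  p ⋆ h   ∎
  where open ≋-Reasoning
newton-h (suc N) = ≋-by-slices slices
  where
  open ≋-Reasoning
  slices : ∀ b a → slice b a ∘ ν h ≋ slice b a ∘ (p ⋆ h)
  slices false a = begin
    ν (slice false a ∘ h)                   ≈⟨ ν-cong (slice-h-false a) ⟩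
    ν (shift a h)                           ≈⟨ ν-shift a h ⟩
    shift a (ν h) ⊕ (+ a) ⊙ shift a h       ≈⟨ ⊕-cong (shift-cong a (newton-h N)) ≋-refl ⟩
    shift a (p ⋆ h) ⊕ (+ a) ⊙ shift a h     ≈⟨ ≋-sym (slice-p⋆-shifts false h h slice-h-false a) ⟩
    slice false a ∘ (p ⋆ h)                 ∎
  slices true a = begin
    ν (slice true a ∘ h)                    ≈⟨ ≋-trans (ν-cong (slice-h-true a)) ν-𝟘 ⟩
    𝟘                                       ≈⟨ ≋-sym (slice-θ-powerSum-⋆ p-powerSumLike a h slice-h-true) ⟩
    slice true a ∘ (p ⋆ h)                  ∎

triangle : ∀ a → ℤΣ.∑ a (λ k → + (a ∸ k)) + ℤΣ.∑ (suc a) (λ k → + suc k * 1ℤ) ≡ + suc a * + suc a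
triangle zero    = refl
triangle (suc a) = begin
  (+ suc a + T₁) + ℤΣ.∑ (suc (suc a)) (λ k → + suc k * 1ℤ)
    ≡⟨ cong (_+_ (+ suc a + T₁)) (ℤΣ.∑-snoc (suc a) (λ k → + suc k * 1ℤ)) ⟩
  (+ suc a + T₁) + (T₂ + + suc (suc a) * 1ℤ)
    ≡⟨ regroup (+ suc a) T₁ T₂ ⟩
  (T₁ + T₂) + (1ℤ + + suc a + + suc a)
    ≡⟨ cong (_+ (1ℤ + + suc a + + suc a)) (triangle a) ⟩
  + suc a * + suc a + (1ℤ + + suc a + + suc a)
    ≡⟨ square (+ suc a) ⟩
  + suc (suc a) * + suc (suc a) ∎
  where
  open ≡-Reasoning
  T₁ = ℤΣ.∑ a (λ k → + (a ∸ k))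
  T₂ = ℤΣ.∑ (suc a) (λ k → + suc k * 1ℤ)
  regroup : ∀ s t u → (s + t) + (u + (1ℤ + s) * 1ℤ) ≡ (t + u) + (1ℤ + s + s)
  regroup = solve-∀
  square : ∀ s → s * s + (1ℤ + s + s) ≡ (1ℤ + s) * (1ℤ + s)
  square = solve-∀

slice-θ-p⋆h~ : ∀ {N} a →
  slice true a ∘ (p ⋆ h~ {suc N}) ≋ (+ suc a) ⊙ shift a (p ⋆ h) ⊕ ℤΣ.∑ a (λ k → + (a ∸ k)) ⊙ shift a h
slice-θ-p⋆h~ a = begin
  slice true a ∘ (p ⋆ h~)
    ≈⟨ slice-powerSum-⋆ p-powerSumLike true a h~ ⟩
  p ⋆ (slice true a ∘ h~) ⊕ ⨁ a (λ k → 1ℤ ⊙ shift (suc k) (slice true (a ∸ suc k) ∘ h~))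
    ≈⟨ ⊕-cong (≋-trans (⋆-cong ≋-refl (slice-h~-true a)) (≋-trans (⋆-⊙ (+ suc a) p (shift a h)) (⊙-cong (+ suc a) (⋆-shift a p h))))
              (≋-trans (⨁-cong a correction) (⨁-⊙ a (λ k → + (a ∸ k)) (shift a h))) ⟩
  (+ suc a) ⊙ shift a (p ⋆ h) ⊕ ℤΣ.∑ a (λ k → + (a ∸ k)) ⊙ shift a h ∎
  where
  open ≋-Reasoning
  correction : ∀ k → k < a → 1ℤ ⊙ shift (suc k) (slice true (a ∸ suc k) ∘ h~) ≋ (+ (a ∸ k)) ⊙ shift a h
  correction k k<a = begin
    1ℤ ⊙ shift (suc k) (slice true (a ∸ suc k) ∘ h~)
      ≈⟨ (λ n → ·ₛ-identityˡ _) ⟩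
    shift (suc k) (slice true (a ∸ suc k) ∘ h~)
      ≈⟨ shift-cong (suc k) (slice-h~-true (a ∸ suc k)) ⟩
    shift (suc k) ((+ suc (a ∸ suc k)) ⊙ shift (a ∸ suc k) h)
      ≈⟨ shift-⊙ (suc k) (+ suc (a ∸ suc k)) (shift (a ∸ suc k) h) ⟩
    (+ suc (a ∸ suc k)) ⊙ shift (suc k) (shift (a ∸ suc k) h)
      ≈⟨ ⊙-cong (+ suc (a ∸ suc k)) (shift-shift-∸ (suc k) a h k<a) ⟩
    (+ suc (a ∸ suc k)) ⊙ shift a h
      ≈⟨ (λ n → ≈-reflexive (cong (λ j → (+ j) ·ₛ shift a h n) (sym (ℕP.+-∸-assoc 1 k<a)))) ⟩
    (+ (a ∸ k)) ⊙ shift a h ∎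

slice-θ-p~⁺⋆h : ∀ {N} a → slice true a ∘ (p~⁺ ⋆ h {suc N}) ≋ ℤΣ.∑ (suc a) (λ k → + suc k * 1ℤ) ⊙ shift a h
slice-θ-p~⁺⋆h a = begin
  slice true a ∘ (p~⁺ ⋆ h)
    ≈⟨ slice-true-fermionSum-⋆ p~⁺-fermionSumLike a h slice-h-true ⟩
  ⨁ (suc a) (λ k → (+ suc k * 1ℤ) ⊙ shift k (slice false (a ∸ k) ∘ h))
    ≈⟨ ⨁-cong (suc a) (λ k k<1+a → ⊙-cong (+ suc k * 1ℤ)
         (≋-trans (shift-cong k (slice-h-false (a ∸ k))) (shift-shift-∸ k a h (ℕP.≤-pred k<1+a)))) ⟩
  ⨁ (suc a) (λ k → (+ suc k * 1ℤ) ⊙ shift a h)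
    ≈⟨ ⨁-⊙ (suc a) (λ k → + suc k * 1ℤ) (shift a h) ⟩
  ℤΣ.∑ (suc a) (λ k → + suc k * 1ℤ) ⊙ shift a h ∎
  where open ≋-Reasoning

newton-h~ : ∀ N → ν h~ ⊕ h~ ≋ p ⋆ h~ ⊕ p~⁺ ⋆ h {N}
newton-h~ zero = begin
  ν h~ ⊕ h~               ≈⟨ ⊕-cong (≋-trans (ν-cong h~-no-variables) ν-𝟘) h~-no-variables ⟩
  𝟘 ⊕ 𝟘                   ≈⟨ ⊕-cong (≋-sym (𝟘-⋆ h~)) (≋-sym (𝟘-⋆ h)) ⟩
  𝟘 ⋆ h~ ⊕ 𝟘 ⋆ h          ≈⟨ ⊕-cong (⋆-cong (≋-sym p-no-variables) ≋-refl)
                                    (⋆-cong (λ r → ≈-sym (≈-trans (·ₛ-cong (+ suc r) (p~-no-variables r)) (·ₛ-zeroʳ (+ suc r)))) ≋-refl) ⟩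
  p ⋆ h~ ⊕ p~⁺ ⋆ h        ∎
  where open ≋-Reasoning
newton-h~ (suc N) = ≋-by-slices slices
  where
  open ≋-Reasoning
  slices : ∀ b a → slice b a ∘ (ν h~ ⊕ h~) ≋ slice b a ∘ (p ⋆ h~ ⊕ p~⁺ ⋆ h)
  slices false a = begin
    ν (slice false a ∘ h~) ⊕ slice false a ∘ h~
      ≈⟨ ⊕-cong (≋-trans (ν-cong (slice-h~-false a)) (ν-shift a h~)) (slice-h~-false a) ⟩
    (shift a (ν h~) ⊕ (+ a) ⊙ shift a h~) ⊕ shift a h~
      ≈⟨ rearrange {X = shift a (ν h~)} {shift a h~} {shift a (p ⋆ h~)} {shift a (p~⁺ ⋆ h)} {(+ a) ⊙ shift a h~}
                   (≋-trans (≋-sym (shift-⊕ a (ν h~) h~))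
                   (≋-trans (shift-cong a (newton-h~ N)) (shift-⊕ a (p ⋆ h~) (p~⁺ ⋆ h)))) ⟩
    (shift a (p ⋆ h~) ⊕ (+ a) ⊙ shift a h~) ⊕ shift a (p~⁺ ⋆ h)
      ≈⟨ ≋-sym (⊕-cong (slice-p⋆-shifts false h~ h~ slice-h~-false a)
                       (≋-trans (slice-false-fermionSum-⋆ p~⁺-fermionSumLike a h)
                                (≋-trans (⋆-cong ≋-refl (slice-h-false a)) (⋆-shift a p~⁺ h)))) ⟩
    slice false a ∘ (p ⋆ h~) ⊕ slice false a ∘ (p~⁺ ⋆ h) ∎
  slices true a = begin
    ν (slice true a ∘ h~) ⊕ slice true a ∘ h~
      ≈⟨ ⊕-cong (ν-cong (slice-h~-true a)) (slice-h~-true a) ⟩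
    ν ((+ suc a) ⊙ shift a h) ⊕ (+ suc a) ⊙ shift a h
      ≈⟨ (λ n m → weighted (+ suc a) (+ n) (+ a) (shift a h n m) (shift a (ν h) n m) (ν-shift a h n m)) ⟩
    (+ suc a) ⊙ shift a (ν h) ⊕ (+ suc a * + suc a) ⊙ shift a h
      ≈⟨ ⊕-cong (⊙-cong (+ suc a) (shift-cong a (newton-h N)))
                (λ n m → trans (cong (_* shift a h n m) (sym (triangle a))) (ℤP.*-distribʳ-+ (shift a h n m) T₁ T₂)) ⟩
    (+ suc a) ⊙ shift a (p ⋆ h) ⊕ (T₁ ⊙ shift a h ⊕ T₂ ⊙ shift a h)
      ≈⟨ (λ n m → sym (ℤP.+-assoc ((+ suc a) * shift a (p ⋆ h) n m) (T₁ * shift a h n m) (T₂ * shift a h n m))) ⟩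
    ((+ suc a) ⊙ shift a (p ⋆ h) ⊕ T₁ ⊙ shift a h) ⊕ T₂ ⊙ shift a h
      ≈⟨ ≋-sym (⊕-cong (slice-θ-p⋆h~ {N} a) (slice-θ-p~⁺⋆h {N} a)) ⟩
    slice true a ∘ (p ⋆ h~) ⊕ slice true a ∘ (p~⁺ ⋆ h) ∎
    where
    T₁ T₂ : ℤ
    T₁ = ℤΣ.∑ a (λ k → + (a ∸ k))
    T₂ = ℤΣ.∑ (suc a) (λ k → + suc k * 1ℤ)
    weighted : ∀ c n a x y → n * x ≡ y + a * x → n * (c * x) + c * x ≡ c * y + (c * (1ℤ + a)) * x
    weighted c n a x y eq = trans (split c n x) (trans (cong (λ t → c * t + c * x) eq) (regroup c a x y))
      where
      split : ∀ c n x → n * (c * x) + c * x ≡ c * (n * x) + c * x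
      split = solve-∀
      regroup : ∀ c a x y → c * (y + a * x) + c * x ≡ c * y + (c * (1ℤ + a)) * x
      regroup = solve-∀

newton-e : ∀ N → ν (e {N}) ≋ p± ⋆ e
newton-e zero = begin
  ν e      ≈⟨ ν-cong e-no-variables ⟩
  ν 𝟙      ≈⟨ ν-𝟙 ⟩
  𝟘        ≈⟨ ≋-sym (𝟘-⋆ e) ⟩
  𝟘 ⋆ e    ≈⟨ ⋆-cong (≋-sym p±-no-variables) ≋-refl ⟩
  p± ⋆ e   ∎
  where open ≋-Reasoning
newton-e (suc N) = ≋-by-slices slices
  where
  open ≋-Reasoning
  open ElementaryLike (e-elementaryLike {N})
  slices : ∀ b a → slice b a ∘ ν e ≋ slice b a ∘ (p± ⋆ e)
  slices false zero = begin
    ν (slice false 0 ∘ e)   ≈⟨ ν-cong slice-x⁰ ⟩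
    ν e                     ≈⟨ newton-e N ⟩
    p± ⋆ e                  ≈⟨ ≋-sym (p±⋆-x⁰ (e-elementaryLike {N})) ⟩
    slice false 0 ∘ (p± ⋆ e) ∎
  slices false (suc zero) = begin
    ν (slice false 1 ∘ e)                    ≈⟨ ≋-trans (ν-cong slice-x¹) (ν-shift 1 e) ⟩
    shift 1 (ν e) ⊕ (+ 1) ⊙ shift 1 e        ≈⟨ ⊕-cong (shift-cong 1 (newton-e N)) ≋-refl ⟩
    shift 1 (p± ⋆ e) ⊕ (+ 1) ⊙ shift 1 e     ≈⟨ ≋-sym (p±⋆-x¹ (e-elementaryLike {N})) ⟩
    slice false 1 ∘ (p± ⋆ e)                 ∎
  slices false (suc (suc k)) = begin
    ν (slice false (suc (suc k)) ∘ e)        ≈⟨ ≋-trans (ν-cong (slice-x² k)) ν-𝟘 ⟩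
    𝟘                                        ≈⟨ ≋-sym (p±⋆-x² (e-elementaryLike {N}) k) ⟩
    slice false (suc (suc k)) ∘ (p± ⋆ e)     ∎
  slices true a = begin
    ν (slice true a ∘ e)                     ≈⟨ ≋-trans (ν-cong (slice-e-θ a)) ν-𝟘 ⟩
    𝟘                                        ≈⟨ ≋-sym (slice-θ-powerSum-⋆ p±-powerSumLike a e slice-e-θ) ⟩
    slice true a ∘ (p± ⋆ e)                  ∎

slice-θ⁰-p±⋆e~ : ∀ {N} → slice true 0 ∘ (p± ⋆ e~ {suc N}) ≋ p± ⋆ e
slice-θ⁰-p±⋆e~ {N} = ≋-trans (slice-powerSum-⋆ p±-powerSumLike true 0 e~)
  (≋-trans (⊕-cong (⋆-cong ≋-refl (slice-e~-θ⁰ {N})) (⨁-empty _)) (⊕-𝟘 (p± ⋆ e)))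

slice-θ⁰-p~±⋆e : ∀ {N} → slice true 0 ∘ (p~± ⋆ e {suc N}) ≋ e
slice-θ⁰-p~±⋆e {N} = ≋-trans (slice-true-fermionSum-⋆ p~±-fermionSumLike 0 e (slice-e-θ {N}))
  (≋-trans (⨁-suc 0 G) (≋-trans (⊕-cong {A = G 0} ≋-refl (⨁-empty (G ∘ suc)))
    (≋-trans (⊕-𝟘 (G 0)) (λ n → ≈-trans (·ₛ-identityˡ _) (ElementaryLike.slice-x⁰ (e-elementaryLike {N}) n)))))
  where
  G : ℕ → Seq N
  G k = negPow k * + suc k * 1ℤ ⊙ shift k (slice false (0 ∸ k) ∘ e)

slice-θˢᵘᶜ-p±⋆e~ : ∀ {N} a → slice true (suc a) ∘ (p± ⋆ e~ {suc N}) ≋ negPow (suc (suc a)) * 1ℤ ⊙ shift (suc a) e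
slice-θˢᵘᶜ-p±⋆e~ {N} a = begin
  slice true (suc a) ∘ (p± ⋆ e~)
    ≈⟨ slice-powerSum-⋆ p±-powerSumLike true (suc a) e~ ⟩
  p± ⋆ (slice true (suc a) ∘ e~) ⊕ ⨁ (suc a) F
    ≈⟨ ⊕-cong (≋-trans (⋆-cong ≋-refl (slice-e~-θˢᵘᶜ {N} a)) (⋆-𝟘 p±)) (⨁-snoc a F) ⟩
  𝟘 ⊕ (⨁ a F ⊕ F a)
    ≈⟨ ⊕-cong {A = 𝟘} ≋-refl (⊕-cong (⨁-zero a early) (⊙-cong (c a) (shift-cong (suc a)
         (≋-trans (slice-index true e~ (ℕP.n∸n≡0 a)) (slice-e~-θ⁰ {N}))))) ⟩
  𝟘 ⊕ (𝟘 ⊕ c a ⊙ shift (suc a) e)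
    ≈⟨ (λ n m → trans (ℤP.+-identityˡ _) (ℤP.+-identityˡ _)) ⟩
  c a ⊙ shift (suc a) e ∎
  where
  open ≋-Reasoning
  c : ℕ → ℤ
  c k = negPow (suc (suc k)) * 1ℤ
  F : ℕ → Seq N
  F k = c k ⊙ shift (suc k) (slice true (suc a ∸ suc k) ∘ e~)
  early : ∀ k → k < a → F k ≋ 𝟘
  early k k<a = ≋-trans (⊙-cong (c k) (shift-cong (suc k)
      (≋-trans (slice-index true e~ (∸-suc k<a)) (slice-e~-θˢᵘᶜ {N} (a ∸ suc k)))))
    (λ n → ≈-trans (·ₛ-cong (c k) (shift-𝟘 (suc k) n)) (·ₛ-zeroʳ (c k)))

slice-θˢᵘᶜ-p~±⋆e : ∀ {N} a →
  slice true (suc a) ∘ (p~± ⋆ e {suc N})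
    ≋ (negPow a * + suc a * 1ℤ + negPow (suc a) * + suc (suc a) * 1ℤ) ⊙ shift (suc a) e
slice-θˢᵘᶜ-p~±⋆e {N} a = begin
  slice true (suc a) ∘ (p~± ⋆ e)
    ≈⟨ slice-true-fermionSum-⋆ p~±-fermionSumLike (suc a) e (slice-e-θ {N}) ⟩
  ⨁ (suc (suc a)) G
    ≈⟨ ≋-trans (⨁-snoc (suc a) G) (⊕-cong (⨁-snoc a G) ≋-refl) ⟩
  (⨁ a G ⊕ G a) ⊕ G (suc a)
    ≈⟨ ⊕-cong (⊕-cong (⨁-zero a early) last-but-one) last ⟩
  (𝟘 ⊕ d a ⊙ shift (suc a) e) ⊕ d (suc a) ⊙ shift (suc a) e
    ≈⟨ (λ n m → trans (cong (_+ d (suc a) * shift (suc a) e n m) (ℤP.+-identityˡ (d a * shift (suc a) e n m)))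
                       (sym (ℤP.*-distribʳ-+ (shift (suc a) e n m) (d a) (d (suc a))))) ⟩
  (d a + d (suc a)) ⊙ shift (suc a) e ∎
  where
  open ≋-Reasoning
  module E = ElementaryLike (e-elementaryLike {N})
  d : ℕ → ℤ
  d k = negPow k * + suc k * 1ℤ
  G : ℕ → Seq N
  G k = d k ⊙ shift k (slice false (suc a ∸ k) ∘ e)
  early : ∀ k → k < a → G k ≋ 𝟘
  early k k<a = ≋-trans (⊙-cong (d k) (shift-cong k
      (≋-trans (slice-index false e (∸-suc-suc k<a))
               (E.slice-x² (a ∸ suc k)))))
    (λ n → ≈-trans (·ₛ-cong (d k) (shift-𝟘 k n)) (·ₛ-zeroʳ (d k)))
  last-but-one : G a ≋ d a ⊙ shift (suc a) e
  last-but-one = ⊙-cong (d a) (≋-trans (shift-cong a (≋-trans (slice-index false e (ℕP.m+n∸n≡m 1 a)) E.slice-x¹))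
                                         (shift-after-1 a e))
  last : G (suc a) ≋ d (suc a) ⊙ shift (suc a) e
  last = ⊙-cong (d (suc a)) (shift-cong (suc a) (≋-trans (slice-index false e (ℕP.n∸n≡0 a)) E.slice-x⁰))

newton-e~ : ∀ N → ν e~ ⊕ e~ ≋ p± ⋆ e~ ⊕ p~± ⋆ e {N}
newton-e~ zero = begin
  ν e~ ⊕ e~              ≈⟨ ⊕-cong (≋-trans (ν-cong e~-no-variables) ν-𝟘) e~-no-variables ⟩
  𝟘 ⊕ 𝟘                  ≈⟨ ⊕-cong (≋-sym (𝟘-⋆ e~)) (≋-sym (𝟘-⋆ e)) ⟩
  𝟘 ⋆ e~ ⊕ 𝟘 ⋆ e         ≈⟨ ⊕-cong (⋆-cong (≋-sym p±-no-variables) ≋-refl) (⋆-cong (≋-sym p~±-no-variables) ≋-refl) ⟩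
  p± ⋆ e~ ⊕ p~± ⋆ e      ∎
  where open ≋-Reasoning
newton-e~ (suc N) = ≋-by-slices slices
  where
  open ≋-Reasoning
  module E  = ElementaryLike (e-elementaryLike {N})
  module E~ = ElementaryLike (e~-elementaryLike {N})
  fermion-x : ∀ a → slice false a ∘ (p~± {suc N} ⋆ e) ≋ p~± ⋆ (slice false a ∘ e)
  fermion-x a = slice-false-fermionSum-⋆ (p~±-fermionSumLike {N}) a e
  slices : ∀ b a → slice b a ∘ (ν e~ ⊕ e~) ≋ slice b a ∘ (p± ⋆ e~ ⊕ p~± ⋆ e)
  slices false zero = begin
    ν (slice false 0 ∘ e~) ⊕ slice false 0 ∘ e~
      ≈⟨ ⊕-cong (ν-cong E~.slice-x⁰) E~.slice-x⁰ ⟩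
    ν e~ ⊕ e~
      ≈⟨ newton-e~ N ⟩
    p± ⋆ e~ ⊕ p~± ⋆ e
      ≈⟨ ≋-sym (⊕-cong (p±⋆-x⁰ (e~-elementaryLike {N})) (≋-trans (fermion-x 0) (⋆-cong ≋-refl E.slice-x⁰))) ⟩
    slice false 0 ∘ (p± ⋆ e~) ⊕ slice false 0 ∘ (p~± ⋆ e) ∎
  slices false (suc zero) = begin
    ν (slice false 1 ∘ e~) ⊕ slice false 1 ∘ e~
      ≈⟨ ⊕-cong (≋-trans (ν-cong E~.slice-x¹) (ν-shift 1 e~)) E~.slice-x¹ ⟩
    (shift 1 (ν e~) ⊕ (+ 1) ⊙ shift 1 e~) ⊕ shift 1 e~
      ≈⟨ rearrange {X = shift 1 (ν e~)} {shift 1 e~} {shift 1 (p± ⋆ e~)} {shift 1 (p~± ⋆ e)} {(+ 1) ⊙ shift 1 e~}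
           (≋-trans (≋-sym (shift-⊕ 1 (ν e~) e~)) (≋-trans (shift-cong 1 (newton-e~ N)) (shift-⊕ 1 (p± ⋆ e~) (p~± ⋆ e)))) ⟩
    (shift 1 (p± ⋆ e~) ⊕ (+ 1) ⊙ shift 1 e~) ⊕ shift 1 (p~± ⋆ e)
      ≈⟨ ≋-sym (⊕-cong (p±⋆-x¹ (e~-elementaryLike {N}))
                       (≋-trans (fermion-x 1) (≋-trans (⋆-cong ≋-refl E.slice-x¹) (⋆-shift 1 p~± e)))) ⟩
    slice false 1 ∘ (p± ⋆ e~) ⊕ slice false 1 ∘ (p~± ⋆ e) ∎
  slices false (suc (suc k)) = begin
    ν (slice false (suc (suc k)) ∘ e~) ⊕ slice false (suc (suc k)) ∘ e~
      ≈⟨ ⊕-cong (≋-trans (ν-cong (E~.slice-x² k)) ν-𝟘) (E~.slice-x² k) ⟩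
    𝟘 ⊕ 𝟘
      ≈⟨ ≋-sym (⊕-cong (p±⋆-x² (e~-elementaryLike {N}) k)
                       (≋-trans (fermion-x (suc (suc k))) (≋-trans (⋆-cong ≋-refl (E.slice-x² k)) (⋆-𝟘 (p~± {N}))))) ⟩
    slice false (suc (suc k)) ∘ (p± ⋆ e~) ⊕ slice false (suc (suc k)) ∘ (p~± ⋆ e) ∎
  slices true zero = begin
    ν (slice true 0 ∘ e~) ⊕ slice true 0 ∘ e~
      ≈⟨ ⊕-cong (ν-cong (slice-e~-θ⁰ {N})) (slice-e~-θ⁰ {N}) ⟩
    ν e ⊕ e
      ≈⟨ ⊕-cong (newton-e N) ≋-refl ⟩
    p± ⋆ e ⊕ e
      ≈⟨ ≋-sym (⊕-cong (slice-θ⁰-p±⋆e~ {N}) (slice-θ⁰-p~±⋆e {N})) ⟩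
    slice true 0 ∘ (p± ⋆ e~) ⊕ slice true 0 ∘ (p~± ⋆ e) ∎
  slices true (suc a) = begin
    ν (slice true (suc a) ∘ e~) ⊕ slice true (suc a) ∘ e~
      ≈⟨ ⊕-cong (≋-trans (ν-cong (slice-e~-θˢᵘᶜ {N} a)) ν-𝟘) (slice-e~-θˢᵘᶜ {N} a) ⟩
    𝟘 ⊕ 𝟘
      ≈⟨ (λ n m → cancel (negPow a) (+ a) (shift (suc a) e n m)) ⟩
    negPow (suc (suc a)) * 1ℤ ⊙ shift (suc a) e ⊕ (negPow a * + suc a * 1ℤ + negPow (suc a) * + suc (suc a) * 1ℤ) ⊙ shift (suc a) e
      ≈⟨ ≋-sym (⊕-cong (slice-θˢᵘᶜ-p±⋆e~ {N} a) (slice-θˢᵘᶜ-p~±⋆e {N} a)) ⟩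
    slice true (suc a) ∘ (p± ⋆ e~) ⊕ slice true (suc a) ∘ (p~± ⋆ e) ∎
    where
    cancel : ∀ x A y → 0ℤ + 0ℤ ≡ (- (- x)) * 1ℤ * y + (x * (1ℤ + A) * 1ℤ + (- x) * (1ℤ + (1ℤ + A)) * 1ℤ) * y
    cancel = solve-∀

private
  one-more : ∀ k x → (1ℤ + k) * x ≡ k * x + x
  one-more = solve-∀

Σ-from-0 : ∀ {N} n (F : ℕ → SPoly N) → Σ[ 0 to n ] F ≈ ∑ (suc n) F
Σ-from-0 n F = PolySums.sumList-applyUpTo (λ i → 0 ℕ.+ i) (suc n) F

Σ-from-1 : ∀ {N} n (F : ℕ → SPoly N) → F 0 ≈ 0ₛ → ∑ (suc n) F ≈ Σ[ 1 to n ] F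
Σ-from-1 n F F₀≈0 = ≈-trans (+ₛ-cong F₀≈0 ≈-refl)
  (≈-trans (λ m → ℤP.+-identityˡ (∑ n (F ∘ suc) m)) (≈-sym (PolySums.sumList-applyUpTo (λ i → 1 ℕ.+ i) n F)))

newton-h-Σ : ∀ N n → (+ n) ·ₛ h {N} n ≈ Σ[ 1 to n ] (λ r → p r *ₛ h (n ∸ r))
newton-h-Σ N n = ≈-trans (newton-h N n)
  (≈-trans (⋆-at p h n) (Σ-from-1 n (λ r → p r *ₛ h (n ∸ r)) (*ₛ-zeroˡ (h n))))

newton-e-Σ : ∀ N n → (+ n) ·ₛ e {N} n ≈ Σ[ 1 to n ] (λ r → negPow (suc r) ·ₛ (p r *ₛ e (n ∸ r)))
newton-e-Σ N n = begin
  (+ n) ·ₛ e n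
    ≈⟨ ≈-trans (newton-e N n) (⋆-at p± e n) ⟩
  ∑ (suc n) (λ r → p± r *ₛ e (n ∸ r))
    ≈⟨ ∑-cong (suc n) {g = F} (λ r _ → ·ₛ-*ₛ (negPow (suc r)) (p r) (e (n ∸ r))) ⟩
  ∑ (suc n) F
    ≈⟨ Σ-from-1 n F (≈-trans (·ₛ-cong (negPow 1) (*ₛ-zeroˡ (e n))) (·ₛ-zeroʳ (negPow 1))) ⟩
  Σ[ 1 to n ] F ∎
  where
  open ≈-Reasoning
  F : ℕ → SPoly N
  F r = negPow (suc r) ·ₛ (p r *ₛ e (n ∸ r))

newton-h~-Σ : ∀ N n →
  (+ suc n) ·ₛ h~ {N} n ≈ Σ[ 0 to n ] (λ r → p r *ₛ h~ (n ∸ r) +ₛ (+ suc r) ·ₛ (p~ r *ₛ h (n ∸ r)))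
newton-h~-Σ N n = begin
  (+ suc n) ·ₛ h~ n
    ≈⟨ (λ m → one-more (+ n) (h~ n m)) ⟩
  (ν h~ ⊕ h~) n
    ≈⟨ ≈-trans (newton-h~ N n) (+ₛ-cong (⋆-at p h~ n) (⋆-at p~⁺ h n)) ⟩
  ∑ (suc n) F +ₛ ∑ (suc n) G
    ≈⟨ ≈-sym (∑-∙ (suc n) F G) ⟩
  ∑ (suc n) (λ r → F r +ₛ G r)
    ≈⟨ ∑-cong (suc n) {g = H} (λ r _ → +ₛ-cong {f = F r} ≈-refl (·ₛ-*ₛ (+ suc r) (p~ r) (h (n ∸ r)))) ⟩
  ∑ (suc n) H
    ≈⟨ ≈-sym (Σ-from-0 n H) ⟩
  Σ[ 0 to n ] H ∎
  where
  open ≈-Reasoning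
  F G H : ℕ → SPoly N
  F r = p r *ₛ h~ (n ∸ r)
  G r = p~⁺ r *ₛ h (n ∸ r)
  H r = p r *ₛ h~ (n ∸ r) +ₛ (+ suc r) ·ₛ (p~ r *ₛ h (n ∸ r))

newton-e~-Σ : ∀ N n →
  (+ suc n) ·ₛ e~ {N} n
    ≈ Σ[ 0 to n ] (λ r → negPow (suc r) ·ₛ (p r *ₛ e~ (n ∸ r) -ₛ (+ suc r) ·ₛ (p~ r *ₛ e (n ∸ r))))
newton-e~-Σ N n = begin
  (+ suc n) ·ₛ e~ n
    ≈⟨ (λ m → one-more (+ n) (e~ n m)) ⟩
  (ν e~ ⊕ e~) n
    ≈⟨ ≈-trans (newton-e~ N n) (+ₛ-cong (⋆-at p± e~ n) (⋆-at p~± e n)) ⟩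
  ∑ (suc n) F +ₛ ∑ (suc n) G
    ≈⟨ ≈-sym (∑-∙ (suc n) F G) ⟩
  ∑ (suc n) (λ r → F r +ₛ G r)
    ≈⟨ ∑-cong (suc n) {g = H} (λ r _ m → trans (cong₂ _+_ (·ₛ-*ₛ (negPow (suc r)) (p r) (e~ (n ∸ r)) m)
                                                         (·ₛ-*ₛ (negPow r * + suc r) (p~ r) (e (n ∸ r)) m))
                                               (signs (negPow r) (+ suc r) ((p r *ₛ e~ (n ∸ r)) m) ((p~ r *ₛ e (n ∸ r)) m))) ⟩
  ∑ (suc n) H
    ≈⟨ ≈-sym (Σ-from-0 n H) ⟩
  Σ[ 0 to n ] H ∎
  where
  open ≈-Reasoning
  F G H : ℕ → SPoly N
  F r = p± r *ₛ e~ (n ∸ r)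
  G r = p~± r *ₛ e (n ∸ r)
  H r = negPow (suc r) ·ₛ (p r *ₛ e~ (n ∸ r) -ₛ (+ suc r) ·ₛ (p~ r *ₛ e (n ∸ r)))
  signs : ∀ x c u v → - x * u + x * c * v ≡ - x * (u + - 1ℤ * (c * v))
  signs = solve-∀

lemma3p6 : (N : ℕ) →
    (∀ (n : ℕ) → 1 ≤ n →
       (+ n) ·ₛ h {N} n ≈ Σ[ 1 to n ] (λ r → p r *ₛ h (n ∸ r)))
    × (∀ (n : ℕ) → 1 ≤ n →
       (+ n) ·ₛ e {N} n ≈ Σ[ 1 to n ] (λ r → negPow (suc r) ·ₛ (p r *ₛ e (n ∸ r))))
    × (∀ (n : ℕ) →
       (+ suc n) ·ₛ h~ {N} n
         ≈ Σ[ 0 to n ] (λ r → p r *ₛ h~ (n ∸ r) +ₛ (+ suc r) ·ₛ (p~ r *ₛ h (n ∸ r))))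
    × (∀ (n : ℕ) →
       (+ suc n) ·ₛ e~ {N} n
         ≈ Σ[ 0 to n ] (λ r → negPow (suc r) ·ₛ (p r *ₛ e~ (n ∸ r) -ₛ (+ suc r) ·ₛ (p~ r *ₛ e (n ∸ r)))))
lemma3p6 N = (λ n _ → newton-h-Σ N n) , (λ n _ → newton-e-Σ N n) , newton-h~-Σ N , newton-e~-Σ N
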